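{- Let $p$ be a prime and let $A=(a_1,\dots,a_p)$ be an exceptional sequence of $p$ nonzero elements of $\mathbb{F}_p$. Then one of the following holds. (i) $\dim(A)=1$ and there exists $r\in\mathbb{F}_p^*$ such that $(a_1,\dots,a_p)=(r,\dots,r)$. (ii) $\dim(A)=p-2$ and there exist $t\in[1,p-3]$, a permutation $\sigma$ of $[1,p]$ and $r\in\mathbb{F}_p^*$ such that $(a_{\sigma(1)},\dots,a_{\sigma(p)})$ consists of $t$ copies of $r$, followed by $p-2-t$ copies of $-r$, followed by $-(t+1)r,-(t+1)r$.
   Context: For $A=(a_1,\dots,a_\ell)$ over $\mathbb{F}_p^*$, $\mathcal{S}_A=\{x\in\{0,1\}^\ell : \sum_i a_ix_i=0 \text{ in } \mathbb{F}_p\}$, each $x$ identified with the subset $\{i : x_i=1\}$ of $[1,\ell]$, and $\dim(A)$ is the dimension of the $\mathbb{F}_p$-linear span of $\mathcal{S}_A$. A sequence $A$ of $\ell\leqslant p$ nonzero elements is called exceptional if there exist two distinct $i,j\in[1,\ell]$ such that $|\{i,j\}\cap x|\in\{0,2\}$ for every $x\in\mathcal{S}_A$. -}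

module Defs where

open import Data.Nat using (ℕ; zero; suc; _+_; _*_; _∸_; _≤_; _<_)
open import Data.Fin using (Fin; toℕ)
open import Data.Bool using (Bool; true; false)
open import Data.Product using (Σ; ∃; ∃-syntax; _×_; _,_)
open import Relation.Binary.PropositionalEquality using (_≡_; _≢_)

-- Congruence modulo p on ℕ (elements of 𝔽_p are represented by natural numbers mod p).
infix 4 _≡_[mod_]
_≡_[mod_] : ℕ → ℕ → ℕ → Set
a ≡ b [mod p ] = ∃[ k ] ∃[ m ] (a + k * p ≡ b + m * p)

∑ : (n : ℕ) → (Fin n → ℕ) → ℕ
∑ zero    f = 0
∑ (suc n) f = f Fin.zero + ∑ n (λ i → f (Fin.suc i))

-- a vector of 𝔽_p^ℓ, entries read modulo p
Vector : ℕ → Set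
Vector ℓ = Fin ℓ → ℕ

bit : Bool → ℕ
bit true  = 1
bit false = 0

InS : (p ℓ : ℕ) → (Fin ℓ → Fin p) → (Fin ℓ → Bool) → Set
InS p ℓ a x = ∑ ℓ (λ i → toℕ (a i) * bit (x i)) ≡ 0 [mod p ]

-- 𝒮_A viewed as a set of vectors of 𝔽_p^ℓ
SVec : (p ℓ : ℕ) → (Fin ℓ → Fin p) → Vector ℓ → Set
SVec p ℓ a u = ∃[ x ] (InS p ℓ a x × (∀ i → u i ≡ bit (x i)))

lincomb : {ℓ : ℕ} (p k : ℕ) → (Fin k → Fin p) → (Fin k → Vector ℓ) → Vector ℓ
lincomb p k c v i = ∑ k (λ j → toℕ (c j) * v j i)

InSpanFam : {ℓ : ℕ} (p k : ℕ) → (Fin k → Vector ℓ) → Vector ℓ → Set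
InSpanFam p k v w = ∃[ c ] (∀ i → w i ≡ lincomb p k c v i [mod p ])

InSpan : {ℓ : ℕ} (p : ℕ) → (Vector ℓ → Set) → Vector ℓ → Set
InSpan {ℓ} p S w = ∃[ k ] Σ (Fin k → Vector ℓ) (λ v → (∀ j → S (v j)) × InSpanFam p k v w)

LinIndep : {ℓ : ℕ} (p k : ℕ) → (Fin k → Vector ℓ) → Set
LinIndep {ℓ} p k v = ∀ (c : Fin k → Fin p) →
  (∀ i → lincomb p k c v i ≡ 0 [mod p ]) → ∀ j → toℕ (c j) ≡ 0

HasDim : {ℓ : ℕ} (p : ℕ) → (Vector ℓ → Set) → ℕ → Set
HasDim {ℓ} p S d = Σ (Fin d → Vector ℓ) (λ b →
  (∀ j → InSpan p S (b j)) × LinIndep p d b × (∀ u → S u → InSpanFam p d b u))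

DimEq : (p ℓ : ℕ) → (Fin ℓ → Fin p) → ℕ → Set
DimEq p ℓ a d = HasDim p (SVec p ℓ a) d

-- A is exceptional (ℓ ≤ p is imposed separately)
Exceptional : (p ℓ : ℕ) → (Fin ℓ → Fin p) → Set
Exceptional p ℓ a = ∃[ i ] ∃[ j ] (i ≢ j × (∀ x → InS p ℓ a x → x i ≡ x j))

module Submission where

-- The additive tool is the growth of subset sums (subset-sum-hits): the subset sums of
-- d indices with nonzero values meet every set of at least p - d residues.  Let R be the
-- p - 2 indices other than i₀, j₀.  Growth over R shows a_{i₀} = a_{j₀} = c
-- (ends-equal), and growth over R minus two indices shows that any two values on R are
-- equal or opposite (equal-or-opposite).  So R splits into t indices of value r and s of
-- value -r, and comparing the multiples of r realised by subsets of R with -c forces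
-- c = -(t + 1) r (end-value).  If s = 0 the sequence is constant and its dimension is 1
-- (constant-dim1).  Otherwise the indices listed in the order P, N, i₀, j₀ give a
-- permutation under which the sequence has the two-block shape; an explicit triangular
-- basis shows that such a sequence has dimension p - 2 (TwoBlockDimension), and
-- dimension is invariant under permutation (Permuted).

open import Defs
open import Data.Nat
  using (ℕ; zero; suc; _+_; _*_; _∸_; _≤_; _<_; z≤n; s≤s; NonZero; ≢-nonZero; ≢-nonZero⁻¹; _%_; _/_; _≟_; _<?_; _≤?_)
open import Data.Nat.Properties
open import Data.Nat.DivMod
open import Data.Nat.Divisibility using (_∣_; m%n≡0⇒n∣m; n∣m⇒m%n≡0)
open import Data.Nat.Primality using (Prime; euclidsLemma; prime⇒nonZero)
open import Data.Nat.Coprimality using (coprime-Bézout; prime⇒coprime)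
open import Data.Nat.GCD using (module Bézout)
open import Data.Nat.Tactic.RingSolver using (solve-∀)
open import Data.Fin using (Fin; toℕ; fromℕ<) renaming (zero to fzero; suc to fsuc)
open import Data.Fin.Properties using (toℕ-injective; toℕ<n; toℕ-fromℕ<; fromℕ<-toℕ; pigeonhole)
  renaming (_≟_ to _≟ᶠ_; suc-injective to fsuc-injective)
open import Data.Fin.Permutation using (Permutation′; _⟨$⟩ʳ_; _⟨$⟩ˡ_; permutation; flip; inverseˡ; inverseʳ)
open import Data.Bool using (Bool; true; false; if_then_else_; _∨_)
open import Data.Bool.Properties using (∨-zeroʳ)
open import Data.Product using (∃-syntax; Σ-syntax; _×_; _,_; proj₁; proj₂)
open import Data.Sum using (_⊎_; inj₁; inj₂)
open import Data.Empty using (⊥; ⊥-elim)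
open import Function using (_∘_)
open import Relation.Nullary using (¬_; Dec; yes; no; does; ¬?)
open import Relation.Nullary.Decidable using (dec-true; dec-false)
open import Relation.Unary using (Decidable)
open import Relation.Binary using (tri<; tri≈; tri>)
open import Relation.Binary.Bundles using (Setoid)
open import Relation.Binary.PropositionalEquality
  using (_≡_; _≢_; refl; sym; trans; cong; cong₂; subst; subst₂; ≢-sym; module ≡-Reasoning)
import Relation.Binary.Reasoning.Setoid as SetoidReasoning
open import Data.List using (List; []; _∷_; length; _++_; filter; map; allFin; take)
open import Data.List.Properties using (filter-accept; filter-reject; filter-all; length-tabulate; length-take; length-++)
open import Data.List.Relation.Unary.All as All using (All; []; _∷_; all?)
open import Data.List.Relation.Unary.All.Properties using (¬Any⇒All¬; ¬All⇒Any¬; All¬⇒¬Any; take⁺)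
open import Data.List.Relation.Unary.Any using (here; there; index; any?)
open import Data.List.Relation.Unary.AllPairs using ([]; _∷_)
open import Data.List.Relation.Unary.Unique.Propositional using (Unique)
open import Data.List.Relation.Unary.Unique.Propositional.Properties using (allFin⁺; filter⁺; ++⁺)
  renaming (take⁺ to take⁺ᵘ)
open import Data.List.Membership.Propositional using (_∈_; _∉_; find)
open import Data.List.Membership.Propositional.Properties
  using (∈-allFin; ∈-map⁻; ∈-filter⁺; ∈-filter⁻; ∈-++⁺ˡ; ∈-++⁺ʳ; ∈-++⁻)
open import Algebra.Properties.CommutativeMonoid.Sum +-0-commutativeMonoid using (sum; sum-permute)

module Residues (p : ℕ) ⦃ _ : NonZero p ⦄ where

  infix 4 _≋_ _≋?_
  _≋_ : ℕ → ℕ → Set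
  x ≋ y = x % p ≡ y % p

  ≋-setoid : Setoid _ _
  ≋-setoid = record { Carrier = ℕ ; _≈_ = _≋_
                    ; isEquivalence = record { refl = refl ; sym = sym ; trans = trans } }

  module ≋-Reasoning = SetoidReasoning ≋-setoid

  ≡⇒≋ : ∀ {x y} → x ≡ y → x ≋ y
  ≡⇒≋ = cong (_% p)

  _≋?_ : ∀ x y → Dec (x ≋ y)
  x ≋? y = x % p ≟ y % p

  +-cong : ∀ {a b c d} → a ≋ b → c ≋ d → a + c ≋ b + d
  +-cong {a} {b} {c} {d} a≋b c≋d = begin
    (a + c) % p               ≡⟨ %-distribˡ-+ a c p ⟩
    (a % p + c % p) % p       ≡⟨ cong₂ (λ u v → (u + v) % p) a≋b c≋d ⟩
    (b % p + d % p) % p       ≡⟨ %-distribˡ-+ b d p ⟨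
    (b + d) % p               ∎
    where open ≡-Reasoning

  *-cong : ∀ {a b c d} → a ≋ b → c ≋ d → a * c ≋ b * d
  *-cong {a} {b} {c} {d} a≋b c≋d = begin
    (a * c) % p               ≡⟨ %-distribˡ-* a c p ⟩
    (a % p * (c % p)) % p     ≡⟨ cong₂ (λ u v → (u * v) % p) a≋b c≋d ⟩
    (b % p * (d % p)) % p     ≡⟨ %-distribˡ-* b d p ⟨
    (b * d) % p               ∎
    where open ≡-Reasoning

  +-congˡ : ∀ c {a b} → a ≋ b → c + a ≋ c + b
  +-congˡ c = +-cong {c} refl

  +-congʳ : ∀ c {a b} → a ≋ b → a + c ≋ b + c
  +-congʳ c e = +-cong e (refl {x = c % p})

  *-congˡ : ∀ c {a b} → a ≋ b → c * a ≋ c * b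
  *-congˡ c = *-cong {c} refl

  *-congʳ : ∀ c {a b} → a ≋ b → a * c ≋ b * c
  *-congʳ c e = *-cong e (refl {x = c % p})

  multiple≋0 : ∀ k → k * p ≋ 0
  multiple≋0 k = trans (m*n%n≡0 k p) (sym (m*n%n≡0 0 p))

  +-multiple : ∀ x k → x + k * p ≋ x
  +-multiple x k = [m+kn]%n≡m%n x k p

  ≋⇒mod : ∀ {x y} → x ≋ y → x ≡ y [mod p ]
  ≋⇒mod {x} {y} e = y / p , x / p , (begin
    x + y / p * p                   ≡⟨ cong (_+ y / p * p) (m≡m%n+[m/n]*n x p) ⟩
    x % p + x / p * p + y / p * p   ≡⟨ cong (λ u → u + x / p * p + y / p * p) e ⟩
    y % p + x / p * p + y / p * p   ≡⟨ swap (y % p) (x / p * p) (y / p * p) ⟩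
    y % p + y / p * p + x / p * p   ≡⟨ cong (_+ x / p * p) (m≡m%n+[m/n]*n y p) ⟨
    y + x / p * p                   ∎)
    where
    open ≡-Reasoning
    swap : ∀ a b c → a + b + c ≡ a + c + b
    swap = solve-∀

  mod⇒≋ : ∀ {x y} → x ≡ y [mod p ] → x ≋ y
  mod⇒≋ {x} {y} (k , m , e) = trans (sym (+-multiple x k)) (trans (≡⇒≋ e) (+-multiple y m))

  +-cancelʳ : ∀ {a b} c → a + c ≋ b + c → a ≋ b
  +-cancelʳ {a} {b} c e with ≋⇒mod e
  ... | k , m , eq = mod⇒≋ (k , m , +-cancelʳ-≡ c _ _ (trans (swap a c (k * p)) (trans eq (sym (swap b c (m * p))))))
    where
    swap : ∀ a c d → a + d + c ≡ a + c + d
    swap = solve-∀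

  +-cancelˡ : ∀ {a b} c → c + a ≋ c + b → a ≋ b
  +-cancelˡ {a} {b} c e = +-cancelʳ c (trans (≡⇒≋ (+-comm a c)) (trans e (≡⇒≋ (+-comm c b))))

  ≋⇒≡ : ∀ {x y} → x < p → y < p → x ≋ y → x ≡ y
  ≋⇒≡ x<p y<p e = trans (sym (m<n⇒m%n≡m x<p)) (trans e (m<n⇒m%n≡m y<p))

  neg : ℕ → ℕ
  neg m = (p ∸ 1) * m

  neg-inverse : ∀ m → neg m + m ≋ 0
  neg-inverse m = trans (≡⇒≋ (begin
    (p ∸ 1) * m + m   ≡⟨ +-comm ((p ∸ 1) * m) m ⟩
    suc (p ∸ 1) * m   ≡⟨ cong (_* m) (suc-pred p) ⟩
    p * m             ≡⟨ *-comm p m ⟩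
    m * p             ∎)) (multiple≋0 m)
    where open ≡-Reasoning

  neg-nonzero : ∀ {m} → ¬ (m ≋ 0) → ¬ (neg m ≋ 0)
  neg-nonzero {m} m≢0 negm≋0 = m≢0 (trans (sym (+-congʳ m negm≋0)) (neg-inverse m))

  neg-injective : ∀ {u v} → neg u ≋ neg v → u ≋ v
  neg-injective {u} {v} e = +-cancelˡ (neg v) (begin
    neg v + u  ≈⟨ +-congʳ u e ⟨
    neg u + u  ≈⟨ neg-inverse u ⟩
    0          ≈⟨ neg-inverse v ⟨
    neg v + v  ∎)
    where open ≋-Reasoning

  residue : ℕ → Fin p
  residue x = x mod p

  toℕ-residue : ∀ x → toℕ (residue x) ≡ x % p
  toℕ-residue x = toℕ-fromℕ< _

  residue≋ : ∀ x → toℕ (residue x) ≋ x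
  residue≋ x = trans (cong (_% p) (toℕ-residue x)) (m%n%n≡m%n x p)

  residue-cong : ∀ {x y} → x ≋ y → residue x ≡ residue y
  residue-cong e = toℕ-injective (trans (toℕ-residue _) (trans e (sym (toℕ-residue _))))

  residue-injective : ∀ {x y} → residue x ≡ residue y → x ≋ y
  residue-injective {x} {y} e = trans (sym (residue≋ x)) (trans (cong (λ z → toℕ z % p) e) (residue≋ y))

  residue-toℕ : ∀ (y : Fin p) → residue (toℕ y) ≡ y
  residue-toℕ y = toℕ-injective (trans (toℕ-residue _) (m<n⇒m%n≡m (toℕ<n y)))

  toℕ≋0 : ∀ (y : Fin p) → toℕ y ≋ 0 → toℕ y ≡ 0
  toℕ≋0 y = ≋⇒≡ (toℕ<n y) (n≢0⇒n>0 (≢-nonZero⁻¹ p))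

  ≋0⇒∣ : ∀ {x} → x ≋ 0 → p ∣ x
  ≋0⇒∣ {x} e = m%n≡0⇒n∣m x p (trans e (m*n%n≡0 0 p))

  module Field (p-prime : Prime p) where

    no-zero-divisors : ∀ a b → a * b ≋ 0 → a ≋ 0 ⊎ b ≋ 0
    no-zero-divisors a b e with euclidsLemma a b p-prime (≋0⇒∣ e)
    ... | inj₁ p∣a = inj₁ (trans (n∣m⇒m%n≡0 a p p∣a) (sym (m*n%n≡0 0 p)))
    ... | inj₂ p∣b = inj₂ (trans (n∣m⇒m%n≡0 b p p∣b) (sym (m*n%n≡0 0 p)))

    inverse : ∀ r → ¬ (r ≋ 0) → ∃[ s ] (s * r ≋ 1)
    inverse r r≢0 with coprime-Bézout (prime⇒coprime p-prime ⦃ nz ⦄ (m%n<n r p))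
      where
      nz : NonZero (r % p)
      nz = ≢-nonZero (λ e → r≢0 (trans e (sym (m*n%n≡0 0 p))))
    ... | Bézout.+- x y eq = neg y , +-cancelʳ (y * r) (begin
          neg y * r + y * r  ≡⟨ *-distribʳ-+ r (neg y) y ⟨
          (neg y + y) * r    ≈⟨ *-congʳ r (neg-inverse y) ⟩
          0                  ≈⟨ multiple≋0 x ⟨
          x * p              ≡⟨ eq ⟨
          1 + y * (r % p)    ≈⟨ +-congˡ 1 (*-congˡ y (m%n%n≡m%n r p)) ⟩
          1 + y * r          ∎)
      where open ≋-Reasoning
    ... | Bézout.-+ x y eq = y , (begin
          y * r              ≈⟨ *-congˡ y (m%n%n≡m%n r p) ⟨
          y * (r % p)        ≡⟨ eq ⟨
          1 + x * p          ≈⟨ +-multiple 1 x ⟩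
          1                  ∎)
      where open ≋-Reasoning

    solve-linear : ∀ r c → ¬ (r ≋ 0) → ∃[ m ] (m < p × m * r + c ≋ 0)
    solve-linear r c r≢0 with inverse r r≢0
    ... | s , sr≋1 = m , m%n<n (neg c * s) p , (begin
      m * r + c               ≈⟨ +-congʳ c (*-congʳ r (m%n%n≡m%n (neg c * s) p)) ⟩
      neg c * s * r + c       ≡⟨ cong (_+ c) (*-assoc (neg c) s r) ⟩
      neg c * (s * r) + c     ≈⟨ +-congʳ c (*-congˡ (neg c) sr≋1) ⟩
      neg c * 1 + c           ≡⟨ cong (_+ c) (*-identityʳ (neg c)) ⟩
      neg c + c               ≈⟨ neg-inverse c ⟩
      0                       ∎)
      where
      open ≋-Reasoning
      m = (neg c * s) % p

    *-cancelˡ : ∀ {u v} r → ¬ (r ≋ 0) → r * u ≋ r * v → u ≋ v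
    *-cancelˡ {u} {v} r r≢0 e with inverse r r≢0
    ... | s , sr≋1 = begin
      u            ≡⟨ *-identityˡ u ⟨
      1 * u        ≈⟨ *-congʳ u sr≋1 ⟨
      s * r * u    ≡⟨ *-assoc s r u ⟩
      s * (r * u)  ≈⟨ *-congˡ s e ⟩
      s * (r * v)  ≡⟨ *-assoc s r v ⟨
      s * r * v    ≈⟨ *-congʳ v sr≋1 ⟩
      1 * v        ≡⟨ *-identityˡ v ⟩
      v            ∎
      where open ≋-Reasoning

∑-cong : ∀ n {f g : Fin n → ℕ} → (∀ i → f i ≡ g i) → ∑ n f ≡ ∑ n g
∑-cong zero    e = refl
∑-cong (suc n) e = cong₂ _+_ (e fzero) (∑-cong n (λ i → e (fsuc i)))

∑-zero : ∀ n {f : Fin n → ℕ} → (∀ i → f i ≡ 0) → ∑ n f ≡ 0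
∑-zero zero    e = refl
∑-zero (suc n) e = cong₂ _+_ (e fzero) (∑-zero n (λ i → e (fsuc i)))

∑-*ˡ : ∀ n c (f : Fin n → ℕ) → ∑ n (λ i → c * f i) ≡ c * ∑ n f
∑-*ˡ zero    c f = sym (*-zeroʳ c)
∑-*ˡ (suc n) c f = trans (cong (c * f fzero +_) (∑-*ˡ n c _)) (sym (*-distribˡ-+ c (f fzero) _))

∑-update : ∀ n {f g : Fin n → ℕ} (d : Fin n) e →
           (∀ k → k ≢ d → g k ≡ f k) → g d ≡ f d + e → ∑ n g ≡ ∑ n f + e
∑-update (suc n) {f} {g} fzero e same changed =
  trans (cong₂ _+_ changed (∑-cong n (λ i → same (fsuc i) (λ ())))) (swap (f fzero) e _)
  where
  swap : ∀ a b c → a + b + c ≡ a + c + b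
  swap = solve-∀
∑-update (suc n) {f} {g} (fsuc d) e same changed =
  trans (cong₂ _+_ (same fzero (λ ()))
                   (∑-update n d e (λ k k≢d → same (fsuc k) (λ q → k≢d (fsuc-injective q))) changed))
        (sym (+-assoc (f fzero) _ e))

∑-permute : ∀ n (f : Fin n → ℕ) (σ : Permutation′ n) → ∑ n f ≡ ∑ n (λ i → f (σ ⟨$⟩ʳ i))
∑-permute n f σ = trans (∑≡sum n f) (trans (sum-permute f σ) (sym (∑≡sum n _)))
  where
  ∑≡sum : ∀ n (f : Fin n → ℕ) → ∑ n f ≡ sum f
  ∑≡sum zero    f = refl
  ∑≡sum (suc n) f = cong (f fzero +_) (∑≡sum n (λ i → f (fsuc i)))

sumTo : ℕ → (ℕ → ℕ) → ℕ
sumTo zero    h = 0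
sumTo (suc n) h = h 0 + sumTo n (λ k → h (suc k))

sumTo-cong : ∀ n {h h' : ℕ → ℕ} → (∀ k → k < n → h k ≡ h' k) → sumTo n h ≡ sumTo n h'
sumTo-cong zero    e = refl
sumTo-cong (suc n) e = cong₂ _+_ (e 0 (s≤s z≤n)) (sumTo-cong n (λ k k<n → e (suc k) (s≤s k<n)))

sumTo-+ : ∀ n (f g : ℕ → ℕ) → sumTo n (λ k → f k + g k) ≡ sumTo n f + sumTo n g
sumTo-+ zero    f g = refl
sumTo-+ (suc n) f g = trans (cong (f 0 + g 0 +_) (sumTo-+ n _ _)) (shuffle (f 0) (g 0) _ _)
  where
  shuffle : ∀ a b c d → a + b + (c + d) ≡ a + c + (b + d)
  shuffle = solve-∀

sumTo-*ˡ : ∀ n c (f : ℕ → ℕ) → sumTo n (λ k → c * f k) ≡ c * sumTo n f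
sumTo-*ˡ zero    c f = sym (*-zeroʳ c)
sumTo-*ˡ (suc n) c f = trans (cong (c * f 0 +_) (sumTo-*ˡ n c _)) (sym (*-distribˡ-+ c (f 0) _))

sumTo-const : ∀ n c → sumTo n (λ _ → c) ≡ n * c
sumTo-const zero    c = refl
sumTo-const (suc n) c = cong (c +_) (sumTo-const n c)

sumTo-zero : ∀ n (h : ℕ → ℕ) → (∀ k → k < n → h k ≡ 0) → sumTo n h ≡ 0
sumTo-zero n h e = trans (sumTo-cong n e) (trans (sumTo-const n 0) (*-zeroʳ n))

sumTo-split : ∀ m n h → sumTo (m + n) h ≡ sumTo m h + sumTo n (λ k → h (m + k))
sumTo-split zero    n h = refl
sumTo-split (suc m) n h = trans (cong (h 0 +_) (sumTo-split m n (λ k → h (suc k)))) (sym (+-assoc (h 0) _ _))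

extend : ∀ {n} → (Fin n → ℕ) → ℕ → ℕ
extend {n} f k with k <? n
... | yes k<n = f (fromℕ< k<n)
... | no  _   = 0

extend-toℕ : ∀ {n} (f : Fin n → ℕ) i → extend f (toℕ i) ≡ f i
extend-toℕ {n} f i with toℕ i <? n
... | yes i<n = cong f (fromℕ<-toℕ i i<n)
... | no  i≮n = ⊥-elim (i≮n (toℕ<n i))

extend-fromℕ< : ∀ {n} (f : Fin n → ℕ) k (k<n : k < n) → extend f k ≡ f (fromℕ< k<n)
extend-fromℕ< f k k<n = trans (cong (extend f) (sym (toℕ-fromℕ< k<n))) (extend-toℕ f (fromℕ< k<n))

∑≡sumTo : ∀ n (f : Fin n → ℕ) → ∑ n f ≡ sumTo n (extend f)
∑≡sumTo n f = trans (∑-cong n (λ i → sym (extend-toℕ f i))) (go n (extend f))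
  where
  go : ∀ n h → ∑ n (λ i → h (toℕ i)) ≡ sumTo n h
  go zero    h = refl
  go (suc n) h = cong (h 0 +_) (go n (λ k → h (suc k)))

extend-* : ∀ {n} (f g : Fin n → ℕ) k → extend (λ i → f i * g i) k ≡ extend f k * extend g k
extend-* {n} f g k with k <? n
... | yes _ = refl
... | no  _ = refl

extend-*ʳ : ∀ {n} (f : Fin n → ℕ) (h : ℕ → ℕ) k → extend (λ i → f i * h (toℕ i)) k ≡ extend f k * h k
extend-*ʳ {n} f h k with k <? n
... | yes k<n = cong (λ m → f (fromℕ< k<n) * h m) (toℕ-fromℕ< k<n)
... | no  _   = refl

sumTo-none : ∀ m (f : ℕ → ℕ) (φ : ℕ → Bool) → (∀ j → j < m → φ j ≡ false) →
             sumTo m (λ j → f j * bit (φ j)) ≡ 0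
sumTo-none m f φ off = sumTo-zero m _ (λ j j<m → trans (cong (λ b → f j * bit b) (off j j<m)) (*-zeroʳ (f j)))

sumTo-all : ∀ m (f : ℕ → ℕ) (φ : ℕ → Bool) → (∀ j → j < m → φ j ≡ true) →
            sumTo m (λ j → f j * bit (φ j)) ≡ sumTo m f
sumTo-all m f φ on = sumTo-cong m (λ j j<m → trans (cong (λ b → f j * bit b) (on j j<m)) (*-identityʳ (f j)))

sumTo-one : ∀ m (f : ℕ → ℕ) (φ : ℕ → Bool) j₀ → j₀ < m → φ j₀ ≡ true →
            (∀ j → j < m → j ≢ j₀ → φ j ≡ false) → sumTo m (λ j → f j * bit (φ j)) ≡ f j₀
sumTo-one (suc m) f φ zero _ on off = begin
  f 0 * bit (φ 0) + rest  ≡⟨ cong₂ _+_ (cong (λ b → f 0 * bit b) on) rest≡0 ⟩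
  f 0 * 1 + 0             ≡⟨ trans (+-identityʳ _) (*-identityʳ (f 0)) ⟩
  f 0                     ∎
  where
  open ≡-Reasoning
  rest = sumTo m (λ j → f (suc j) * bit (φ (suc j)))
  rest≡0 : rest ≡ 0
  rest≡0 = sumTo-none m (λ j → f (suc j)) (λ j → φ (suc j)) (λ j j<m → off (suc j) (s≤s j<m) (λ ()))
sumTo-one (suc m) f φ (suc j₀) (s≤s j₀<m) on off = begin
  f 0 * bit (φ 0) + rest  ≡⟨ cong₂ _+_ (cong (λ b → f 0 * bit b) (off 0 (s≤s z≤n) (λ ()))) rest≡ ⟩
  f 0 * 0 + f (suc j₀)    ≡⟨ cong (_+ f (suc j₀)) (*-zeroʳ (f 0)) ⟩
  f (suc j₀)              ∎
  where
  open ≡-Reasoning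
  rest = sumTo m (λ j → f (suc j) * bit (φ (suc j)))
  rest≡ : rest ≡ f (suc j₀)
  rest≡ = sumTo-one m (λ j → f (suc j)) (λ j → φ (suc j)) j₀ j₀<m on
            (λ j j<m j≢j₀ → off (suc j) (s≤s j<m) (λ e → j≢j₀ (suc-injective e)))

sumTo-two : ∀ m (f : ℕ → ℕ) (φ : ℕ → Bool) j₁ j₂ → j₁ < j₂ → j₂ < m → φ j₁ ≡ true → φ j₂ ≡ true →
            (∀ j → j < m → j ≢ j₁ → j ≢ j₂ → φ j ≡ false) → sumTo m (λ j → f j * bit (φ j)) ≡ f j₁ + f j₂
sumTo-two (suc m) f φ zero (suc j₂) _ (s≤s j₂<m) on₁ on₂ off =
  cong₂ _+_ (trans (cong (λ b → f 0 * bit b) on₁) (*-identityʳ (f 0)))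
            (sumTo-one m (λ j → f (suc j)) (λ j → φ (suc j)) j₂ j₂<m on₂
               (λ j j<m j≢j₂ → off (suc j) (s≤s j<m) (λ ()) (λ e → j≢j₂ (suc-injective e))))
sumTo-two (suc m) f φ (suc j₁) (suc j₂) (s≤s j₁<j₂) (s≤s j₂<m) on₁ on₂ off =
  cong₂ _+_ (trans (cong (λ b → f 0 * bit b) (off 0 (s≤s z≤n) (λ ()) (λ ()))) (*-zeroʳ (f 0)))
            (sumTo-two m (λ j → f (suc j)) (λ j → φ (suc j)) j₁ j₂ j₁<j₂ j₂<m on₁ on₂
               (λ j j<m j≢j₁ j≢j₂ → off (suc j) (s≤s j<m) (λ e → j≢j₁ (suc-injective e)) (λ e → j≢j₂ (suc-injective e))))

module SumsModulo (p : ℕ) ⦃ _ : NonZero p ⦄ where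
  open Residues p

  sumTo-cong≋ : ∀ m {f g : ℕ → ℕ} → (∀ j → j < m → f j ≋ g j) → sumTo m f ≋ sumTo m g
  sumTo-cong≋ zero    e = refl
  sumTo-cong≋ (suc m) e = +-cong (e 0 (s≤s z≤n)) (sumTo-cong≋ m (λ j j<m → e (suc j) (s≤s j<m)))

  sumTo-≋0 : ∀ m (f : ℕ → ℕ) → (∀ j → j < m → f j ≋ 0) → sumTo m f ≋ 0
  sumTo-≋0 m f e = trans (sumTo-cong≋ m e) (≡⇒≋ (trans (sumTo-const m 0) (*-zeroʳ m)))

_∈?_ : ∀ {n} (k : Fin n) (L : List (Fin n)) → Dec (k ∈ L)
k ∈? L = any? (k ≟ᶠ_) L

insert : ∀ {ℓ} → (Fin ℓ → Bool) → Fin ℓ → Fin ℓ → Bool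
insert x d k = if does (k ≟ᶠ d) then true else x k

insert-here : ∀ {ℓ} (x : Fin ℓ → Bool) d → insert x d d ≡ true
insert-here x d with d ≟ᶠ d
... | yes _   = refl
... | no  d≢d = ⊥-elim (d≢d refl)

insert-there : ∀ {ℓ} (x : Fin ℓ → Bool) d k → k ≢ d → insert x d k ≡ x k
insert-there x d k k≢d with k ≟ᶠ d
... | yes k≡d = ⊥-elim (k≢d k≡d)
... | no  _   = refl

insertAll : ∀ {ℓ} → (Fin ℓ → Bool) → List (Fin ℓ) → Fin ℓ → Bool
insertAll x []      = x
insertAll x (e ∷ E) = insert (insertAll x E) e

insertAll-∉ : ∀ {ℓ} (x : Fin ℓ → Bool) E k → k ∉ E → insertAll x E k ≡ x k
insertAll-∉ x []      k _   = refl
insertAll-∉ x (e ∷ E) k k∉ = trans (insert-there (insertAll x E) e k (λ k≡e → k∉ (here k≡e)))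
                                   (insertAll-∉ x E k (λ k∈E → k∉ (there k∈E)))

indicator : ∀ {ℓ} → List (Fin ℓ) → Fin ℓ → Bool
indicator L k = does (k ∈? L)

indicator-∉ : ∀ {ℓ} {L : List (Fin ℓ)} {k} → k ∉ L → indicator L k ≡ false
indicator-∉ {L = L} {k} k∉L with k ∈? L
... | yes k∈L = ⊥-elim (k∉L k∈L)
... | no  _   = refl

indicator-∷ : ∀ {ℓ} (d : Fin ℓ) L k → indicator (d ∷ L) k ≡ insert (indicator L) d k
indicator-∷ d L k with k ≟ᶠ d
... | yes refl = refl
... | no  _    = refl

module SubsetSums {p ℓ : ℕ} (a : Fin ℓ → Fin p) where

  weight : (Fin ℓ → Bool) → ℕ
  weight x = ∑ ℓ (λ i → toℕ (a i) * bit (x i))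

  weight-cong : ∀ {x y} → (∀ k → x k ≡ y k) → weight x ≡ weight y
  weight-cong e = ∑-cong _ (λ k → cong (λ b → toℕ (a k) * bit b) (e k))

  weight-empty : weight (λ _ → false) ≡ 0
  weight-empty = ∑-zero ℓ (λ i → *-zeroʳ (toℕ (a i)))

  weight-insert : ∀ x d → x d ≡ false → weight (insert x d) ≡ weight x + toℕ (a d)
  weight-insert x d xd≡false = ∑-update ℓ d (toℕ (a d))
    (λ k k≢d → cong (λ b → toℕ (a k) * bit b) (insert-there x d k k≢d))
    (begin
      toℕ (a d) * bit (insert x d d)  ≡⟨ cong (λ b → toℕ (a d) * bit b) (insert-here x d) ⟩
      toℕ (a d) * 1                   ≡⟨ *-identityʳ (toℕ (a d)) ⟩
      toℕ (a d)                       ≡⟨ cong (_+ toℕ (a d)) (*-zeroʳ (toℕ (a d))) ⟨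
      toℕ (a d) * 0 + toℕ (a d)       ≡⟨ cong (λ b → toℕ (a d) * bit b + toℕ (a d)) xd≡false ⟨
      toℕ (a d) * bit (x d) + toℕ (a d) ∎)
    where open ≡-Reasoning

  listSum : List (Fin ℓ) → ℕ
  listSum []      = 0
  listSum (k ∷ L) = toℕ (a k) + listSum L

  weight-insertAll : ∀ x E → Unique E → (∀ e → e ∈ E → x e ≡ false) →
                     weight (insertAll x E) ≡ weight x + listSum E
  weight-insertAll x []      _            _   = sym (+-identityʳ (weight x))
  weight-insertAll x (e ∷ E) (e∉E ∷ uE) off = begin
    weight (insert (insertAll x E) e)            ≡⟨ weight-insert (insertAll x E) e e-absent ⟩
    weight (insertAll x E) + toℕ (a e)           ≡⟨ cong (_+ toℕ (a e)) (weight-insertAll x E uE (λ k k∈E → off k (there k∈E))) ⟩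
    weight x + listSum E + toℕ (a e)             ≡⟨ shuffle (weight x) (listSum E) (toℕ (a e)) ⟩
    weight x + (toℕ (a e) + listSum E)           ∎
    where
    open ≡-Reasoning
    e-absent : insertAll x E e ≡ false
    e-absent = trans (insertAll-∉ x E e (All¬⇒¬Any e∉E)) (off e (here refl))
    shuffle : ∀ u v w → u + v + w ≡ u + (w + v)
    shuffle = solve-∀

  weight-indicator : ∀ L → Unique L → weight (indicator L) ≡ listSum L
  weight-indicator []      _             = weight-empty
  weight-indicator (k ∷ L) (k∉L ∷ uL) = begin
    weight (indicator (k ∷ L))           ≡⟨ weight-cong (indicator-∷ k L) ⟩
    weight (insert (indicator L) k)      ≡⟨ weight-insert (indicator L) k (indicator-∉ (All¬⇒¬Any k∉L)) ⟩
    weight (indicator L) + toℕ (a k)     ≡⟨ cong (_+ toℕ (a k)) (weight-indicator L uL) ⟩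
    listSum L + toℕ (a k)                ≡⟨ +-comm (listSum L) (toℕ (a k)) ⟩
    listSum (k ∷ L)                      ∎
    where open ≡-Reasoning

nth : ∀ {A : Set} → A → List A → ℕ → A
nth d []       k       = d
nth d (x ∷ xs) zero    = x
nth d (x ∷ xs) (suc k) = nth d xs k

module _ {A : Set} (d : A) where

  nth-∈ : ∀ xs k → k < length xs → nth d xs k ∈ xs
  nth-∈ (x ∷ xs) zero    _         = here refl
  nth-∈ (x ∷ xs) (suc k) (s≤s k<n) = there (nth-∈ xs k k<n)

  nth-++ˡ : ∀ xs ys k → k < length xs → nth d (xs ++ ys) k ≡ nth d xs k
  nth-++ˡ (x ∷ xs) ys zero    _         = refl
  nth-++ˡ (x ∷ xs) ys (suc k) (s≤s k<n) = nth-++ˡ xs ys k k<n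

  nth-++ʳ : ∀ xs ys k → nth d (xs ++ ys) (length xs + k) ≡ nth d ys k
  nth-++ʳ []       ys k = refl
  nth-++ʳ (x ∷ xs) ys k = nth-++ʳ xs ys k

  nth-index : ∀ {y xs} (y∈xs : y ∈ xs) → nth d xs (toℕ (index y∈xs)) ≡ y
  nth-index (here refl) = refl
  nth-index (there m)   = nth-index m

  nth-injective : ∀ {xs} → Unique xs → ∀ j k → j < length xs → k < length xs →
                  nth d xs j ≡ nth d xs k → j ≡ k
  nth-injective {x ∷ xs} _ zero zero _ _ _ = refl
  nth-injective {x ∷ xs} (x∉xs ∷ _) zero (suc k) _ (s≤s k<n) x≡ =
    ⊥-elim (All.lookup x∉xs (nth-∈ xs k k<n) x≡)
  nth-injective {x ∷ xs} (x∉xs ∷ _) (suc j) zero (s≤s j<n) _ ≡x =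
    ⊥-elim (All.lookup x∉xs (nth-∈ xs j j<n) (sym ≡x))
  nth-injective {x ∷ xs} (_ ∷ u) (suc j) (suc k) (s≤s j<n) (s≤s k<n) e =
    cong suc (nth-injective u j k j<n k<n e)

unique-full : ∀ {n} (G : List (Fin n)) → Unique G → n ≤ length G → ∀ z → z ∈ G
unique-full {n} G uG n≤|G| z with z ∈? G
... | yes z∈G = z∈G
... | no  z∉G with pigeonhole (s≤s n≤|G|) (λ i → nth z (z ∷ G) (toℕ i))
...   | i , j , i<j , same = ⊥-elim (<⇒≢ i<j
          (nth-injective z (¬Any⇒All¬ G z∉G ∷ uG) (toℕ i) (toℕ j) (toℕ<n i) (toℕ<n j) same))

length-take≤ : ∀ {A : Set} m (xs : List A) → m ≤ length xs → length (take m xs) ≡ m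
length-take≤ m xs m≤ = trans (length-take m xs) (m≤n⇒m⊓n≡m m≤)

∈⇒length≥1 : ∀ {A : Set} {y : A} {xs} → y ∈ xs → 1 ≤ length xs
∈⇒length≥1 (here _)  = s≤s z≤n
∈⇒length≥1 (there _) = s≤s z≤n

remove : ∀ {n} → Fin n → List (Fin n) → List (Fin n)
remove d = filter (λ k → ¬? (k ≟ᶠ d))

∈-remove⁺ : ∀ {n} {k d : Fin n} {xs} → k ∈ xs → k ≢ d → k ∈ remove d xs
∈-remove⁺ {d = d} = ∈-filter⁺ (λ k → ¬? (k ≟ᶠ d))

∈-remove⁻ : ∀ {n} {k d : Fin n} xs → k ∈ remove d xs → k ∈ xs × k ≢ d
∈-remove⁻ {d = d} xs = ∈-filter⁻ (λ k → ¬? (k ≟ᶠ d)) {xs = xs}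

length-remove : ∀ {n} (d : Fin n) xs → Unique xs → d ∈ xs → suc (length (remove d xs)) ≡ length xs
length-remove d (x ∷ xs) (x∉xs ∷ _) (here refl) = begin
  suc (length (remove x (x ∷ xs)))  ≡⟨ cong (suc ∘ length) (filter-reject (λ k → ¬? (k ≟ᶠ x)) (λ x≢x → x≢x refl)) ⟩
  suc (length (remove x xs))        ≡⟨ cong (suc ∘ length) (filter-all (λ k → ¬? (k ≟ᶠ x)) x-absent) ⟩
  length (x ∷ xs)                   ∎
  where
  open ≡-Reasoning
  x-absent : All (λ k → ¬ (k ≡ x)) xs
  x-absent = All.map (λ x≢k k≡x → x≢k (sym k≡x)) x∉xs
length-remove d (x ∷ xs) (x∉xs ∷ uxs) (there d∈xs) =
  trans (cong (λ ys → suc (length ys)) (filter-accept (λ k → ¬? (k ≟ᶠ d)) (λ x≡d → All.lookup x∉xs d∈xs x≡d)))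
        (cong suc (length-remove d xs uxs d∈xs))

length-partition : ∀ {n} {P : Fin n → Set} (P? : Decidable P) xs →
                   length (filter P? xs) + length (filter (λ k → ¬? (P? k)) xs) ≡ length xs
length-partition P? []       = refl
length-partition P? (x ∷ xs) with P? x
... | yes _ = cong suc (length-partition P? xs)
... | no  _ = trans (+-suc _ _) (cong suc (length-partition P? xs))

module Enumeration {n} (d : Fin n) (L : List (Fin n)) (unique : Unique L)
                   (complete : ∀ y → y ∈ L) (len : length L ≡ n) where

  private
    to : Fin n → Fin n
    to i = nth d L (toℕ i)

    position<n : ∀ y → toℕ (index (complete y)) < n
    position<n y = subst (toℕ (index (complete y)) <_) len (toℕ<n _)

    from : Fin n → Fin n
    from y = fromℕ< (position<n y)

    to-from : ∀ y → to (from y) ≡ y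
    to-from y = trans (cong (nth d L) (toℕ-fromℕ< (position<n y))) (nth-index d (complete y))

    from-to : ∀ i → from (to i) ≡ i
    from-to i = toℕ-injective (trans (toℕ-fromℕ< _)
      (nth-injective d unique _ _ (toℕ<n _) (subst (toℕ i <_) (sym len) (toℕ<n i)) (nth-index d (complete (to i)))))

  σ : Permutation′ n
  σ = permutation to from to-from from-to

SupportedIn : ∀ {ℓ} → List (Fin ℓ) → (Fin ℓ → Bool) → Set
SupportedIn D x = ∀ k → k ∉ D → x k ≡ false

module SubsetSumGrowth (p : ℕ) ⦃ _ : NonZero p ⦄ (p-prime : Prime p) {ℓ : ℕ} (a : Fin ℓ → Fin p) where
  open Residues p
  open Field p-prime
  open SubsetSums a

  -- A set of residues that contains f and is closed under y ↦ y + m, with m ≢ 0, contains 0: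
  -- it contains every f + k m, and k = -f/m gives 0.
  closed⇒zero∈ : ∀ m → ¬ (m ≋ 0) → (G : List (Fin p)) →
                 (∀ y → y ∈ G → residue (toℕ y + m) ∈ G) → ∀ f → f ∈ G → residue 0 ∈ G
  closed⇒zero∈ m m≢0 G closed f f∈G with inverse m m≢0
  ... | s , sm≋1 = subst (_∈ G) (residue-cong reaches0) (orbit (neg (toℕ f) * s))
    where
    orbit : ∀ k → residue (toℕ f + k * m) ∈ G
    orbit zero    = subst (_∈ G) (sym (trans (residue-cong (≡⇒≋ (+-identityʳ (toℕ f)))) (residue-toℕ f))) f∈G
    orbit (suc k) = subst (_∈ G) (residue-cong step) (closed _ (orbit k))
      where
      open ≋-Reasoning
      step : toℕ (residue (toℕ f + k * m)) + m ≋ toℕ f + suc k * m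
      step = begin
        toℕ (residue (toℕ f + k * m)) + m  ≈⟨ +-congʳ m (residue≋ (toℕ f + k * m)) ⟩
        toℕ f + k * m + m                  ≡⟨ shuffle (toℕ f) k m ⟩
        toℕ f + suc k * m                  ∎
        where
        shuffle : ∀ f k m → f + k * m + m ≡ f + (1 + k) * m
        shuffle = solve-∀
    reaches0 : toℕ f + neg (toℕ f) * s * m ≋ 0
    reaches0 = begin
      toℕ f + neg (toℕ f) * s * m    ≡⟨ cong (toℕ f +_) (*-assoc (neg (toℕ f)) s m) ⟩
      toℕ f + neg (toℕ f) * (s * m)  ≈⟨ +-congˡ (toℕ f) (*-congˡ (neg (toℕ f)) sm≋1) ⟩
      toℕ f + neg (toℕ f) * 1        ≡⟨ cong (toℕ f +_) (*-identityʳ (neg (toℕ f))) ⟩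
      toℕ f + neg (toℕ f)            ≡⟨ +-comm (toℕ f) (neg (toℕ f)) ⟩
      neg (toℕ f) + toℕ f            ≈⟨ neg-inverse (toℕ f) ⟩
      0                              ∎
      where open ≋-Reasoning

  _⊖_ : Fin p → Fin ℓ → Fin p
  y ⊖ d = residue (toℕ y + neg (toℕ (a d)))

  -- For D = d ∷ D', either G is closed under subtracting a_d, and then contains the empty
  -- sum 0, or some y ∈ G has y - a_d ∉ G, and we recurse on D' with the larger target
  -- G ∪ {y - a_d}, adding d to the subset if the sum y - a_d is hit.
  subset-sum-hits : (D : List (Fin ℓ)) → Unique D → (∀ d → d ∈ D → ¬ (toℕ (a d) ≋ 0)) →
                    (G : List (Fin p)) → Unique G → ∀ f → f ∈ G → p ≤ length D + length G →
                    ∃[ x ] (SupportedIn D x × residue (weight x) ∈ G)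
  subset-sum-hits [] _ _ G uG f f∈G p≤ =
    (λ _ → false) , (λ _ _ → refl) , subst (_∈ G) (cong residue (sym weight-empty)) (unique-full G uG p≤ (residue 0))
  subset-sum-hits (d ∷ D) (d∉D ∷ uD) nonzero G uG f f∈G p≤ with all? (λ y → (y ⊖ d) ∈? G) G
  ... | yes closed =
    (λ _ → false) , (λ _ _ → refl) ,
    subst (_∈ G) (cong residue (sym weight-empty))
      (closed⇒zero∈ (neg (toℕ (a d))) (neg-nonzero (nonzero d (here refl))) G (λ y → All.lookup closed) f f∈G)
  ... | no not-closed with find (¬All⇒Any¬ (λ y → (y ⊖ d) ∈? G) G not-closed)
  ...   | y , y∈G , y-ad∉G with subset-sum-hits D uD (λ k k∈D → nonzero k (there k∈D)) ((y ⊖ d) ∷ G)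
                                  (¬Any⇒All¬ G y-ad∉G ∷ uG) f (there f∈G) (subst (p ≤_) (sym (+-suc (length D) (length G))) p≤)
  ...     | x , x⊆D , there sum∈G  = x , (λ k k∉ → x⊆D k (λ k∈D → k∉ (there k∈D))) , sum∈G
  ...     | x , x⊆D , here sum≡y-ad = insert x d , supported , subst (_∈ G) (sym hits-y) y∈G
    where
    supported : SupportedIn (d ∷ D) (insert x d)
    supported k k∉ = trans (insert-there x d k (λ k≡d → k∉ (here k≡d))) (x⊆D k (λ k∈D → k∉ (there k∈D)))
    hits-y : residue (weight (insert x d)) ≡ y
    hits-y = trans (residue-cong sum≋y) (residue-toℕ y)
      where
      open ≋-Reasoning
      sum≋y : weight (insert x d) ≋ toℕ y
      sum≋y = begin
        weight (insert x d)                              ≡⟨ weight-insert x d (x⊆D d (λ d∈D → All.lookup d∉D d∈D refl)) ⟩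
        weight x + toℕ (a d)                             ≈⟨ +-congʳ (toℕ (a d)) (residue-injective sum≡y-ad) ⟩
        toℕ y + neg (toℕ (a d)) + toℕ (a d)              ≡⟨ +-assoc (toℕ y) _ _ ⟩
        toℕ y + (neg (toℕ (a d)) + toℕ (a d))            ≈⟨ +-congˡ (toℕ y) (neg-inverse (toℕ (a d))) ⟩
        toℕ y + 0                                        ≡⟨ +-identityʳ (toℕ y) ⟩
        toℕ y                                            ∎

member-in-span : ∀ {ℓ} p ⦃ _ : NonZero p ⦄ (S : Vector ℓ → Set) v → S v → InSpan p S v
member-in-span p S v v∈S = 1 , (λ _ → v) , (λ _ → v∈S) , (λ _ → residue 1) , λ i → ≋⇒mod (sym (begin
  toℕ (residue 1) * v i + 0   ≡⟨ +-identityʳ _ ⟩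
  toℕ (residue 1) * v i       ≈⟨ *-congʳ (v i) (residue≋ 1) ⟩
  1 * v i                     ≡⟨ *-identityˡ (v i) ⟩
  v i                         ∎))
  where
  open Residues p
  open ≋-Reasoning

card : ∀ n → (Fin n → Bool) → ℕ
card n x = ∑ n (λ i → bit (x i))

card≤ : ∀ n x → card n x ≤ n
card≤ zero    x = z≤n
card≤ (suc n) x = +-mono-≤ (bit≤1 (x fzero)) (card≤ n (λ i → x (fsuc i)))
  where
  bit≤1 : ∀ b → bit b ≤ 1
  bit≤1 true  = s≤s z≤n
  bit≤1 false = z≤n

card≡0 : ∀ n x → card n x ≡ 0 → ∀ i → x i ≡ false
card≡0 (suc n) x e fzero with x fzero | e
... | false | _ = refl
card≡0 (suc n) x e (fsuc i) with x fzero | e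
... | false | e' = card≡0 n (λ i → x (fsuc i)) e' i

card≡n : ∀ n x → card n x ≡ n → ∀ i → x i ≡ true
card≡n (suc n) x e i with x fzero in x0
card≡n (suc n) x e fzero    | true  = x0
card≡n (suc n) x e (fsuc i) | true  = card≡n n (λ i → x (fsuc i)) (suc-injective e) i
card≡n (suc n) x e i        | false = ⊥-elim (<-irrefl e (s≤s (card≤ n (λ i → x (fsuc i)))))

-- A constant sequence of p nonzero residues has dimension 1.  Since r |x| ≡ 0 forces
-- p ∣ |x|, its only zero-sum subsets are ∅ and everything, and the all-ones vector is a
-- basis of their span.
constant-dim1 : (p : ℕ) ⦃ _ : NonZero p ⦄ → Prime p → (a : Fin p → Fin p) (r : Fin p) →
                toℕ r ≢ 0 → (∀ i → a i ≡ r) → DimEq p p a 1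
constant-dim1 p p-prime a r r≢0 constant = basis , basis-in-span , independent , spanning
  where
  open Residues p
  open Field p-prime
  open SubsetSums a

  0<p : 0 < p
  0<p = n≢0⇒n>0 (≢-nonZero⁻¹ p)

  ones : Vector p
  ones _ = 1

  basis : Fin 1 → Vector p
  basis _ = ones

  weight≡ : ∀ x → weight x ≡ toℕ r * card p x
  weight≡ x = trans (∑-cong p (λ i → cong (λ z → toℕ z * bit (x i)) (constant i))) (∑-*ˡ p (toℕ r) (λ i → bit (x i)))

  single : ∀ (c : Fin p) v i → toℕ c ≋ v → lincomb p 1 (λ _ → c) basis i ≋ v
  single c v i c≋v = trans (≡⇒≋ (trans (+-identityʳ _) (*-identityʳ _))) c≋v

  ones-in-S : SVec p p a ones
  ones-in-S = (λ _ → true) , ≋⇒mod everything-zero-sum , (λ _ → refl)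
    where
    card-all : ∀ n → card n (λ _ → true) ≡ n
    card-all zero    = refl
    card-all (suc n) = cong suc (card-all n)
    everything-zero-sum : weight (λ _ → true) ≋ 0
    everything-zero-sum = trans (≡⇒≋ (trans (weight≡ _) (cong (toℕ r *_) (card-all p)))) (multiple≋0 (toℕ r))

  basis-in-span : ∀ j → InSpan p (SVec p p a) (basis j)
  basis-in-span _ = member-in-span p (SVec p p a) ones ones-in-S

  independent : LinIndep p 1 basis
  independent c zero-comb fzero =
    toℕ≋0 (c fzero) (trans (sym (single (c fzero) _ (residue 0) refl)) (mod⇒≋ (zero-comb (residue 0))))

  spanning : ∀ u → SVec p p a u → InSpanFam p 1 basis u
  spanning u (x , zero-sum , u≡x) with no-zero-divisors (toℕ r) (card p x) (trans (≡⇒≋ (sym (weight≡ x))) (mod⇒≋ zero-sum))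
  ... | inj₁ r≋0 = ⊥-elim (r≢0 (toℕ≋0 r r≋0))
  ... | inj₂ card≋0 with card p x ≟ p
  ...   | yes full  = (λ _ → residue 1) , λ i → ≋⇒mod (trans (≡⇒≋ (u-at i (card≡n p x full i))) (sym (single (residue 1) 1 i (residue≋ 1))))
    where
    u-at : ∀ i {b} → x i ≡ b → u i ≡ bit b
    u-at i x-i≡b = trans (u≡x i) (cong bit x-i≡b)
  ...   | no  ¬full = (λ _ → residue 0) , λ i → ≋⇒mod (trans (≡⇒≋ (u-at i (card≡0 p x empty i))) (sym (single (residue 0) 0 i (residue≋ 0))))
    where
    u-at : ∀ i {b} → x i ≡ b → u i ≡ bit b
    u-at i x-i≡b = trans (u≡x i) (cong bit x-i≡b)
    empty : card p x ≡ 0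
    empty = ≋⇒≡ (≤∧≢⇒< (card≤ p x) ¬full) 0<p card≋0

module Permuted {p ℓ : ℕ} (a : Fin ℓ → Fin p) (σ : Permutation′ ℓ) where

  aσ : Fin ℓ → Fin p
  aσ i = a (σ ⟨$⟩ʳ i)

  InS-permute : ∀ x → InS p ℓ a x → InS p ℓ aσ (λ i → x (σ ⟨$⟩ʳ i))
  InS-permute x = subst (_≡ 0 [mod p ]) (∑-permute ℓ _ σ)

  InS-unpermute : ∀ x → InS p ℓ aσ x → InS p ℓ a (λ y → x (σ ⟨$⟩ˡ y))
  InS-unpermute x = subst (_≡ 0 [mod p ]) (trans (∑-permute ℓ _ (flip σ))
    (∑-cong ℓ (λ y → cong (λ z → toℕ (a z) * bit (x (σ ⟨$⟩ˡ y))) (inverseʳ σ))))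

  unpermute : Vector ℓ → Vector ℓ
  unpermute v y = v (σ ⟨$⟩ˡ y)

  SVec-unpermute : ∀ v → SVec p ℓ aσ v → SVec p ℓ a (unpermute v)
  SVec-unpermute v (x , zero-sum , v≡x) = (λ y → x (σ ⟨$⟩ˡ y)) , InS-unpermute x zero-sum , (λ y → v≡x (σ ⟨$⟩ˡ y))

  dim-unpermute : ∀ d → DimEq p ℓ aσ d → DimEq p ℓ a d
  dim-unpermute d (b , in-span , independent , spanning) =
    (λ j → unpermute (b j)) , in-span′ , independent′ , spanning′
    where
    in-span′ : ∀ j → InSpan p (SVec p ℓ a) (unpermute (b j))
    in-span′ j with in-span j
    ... | k , v , v∈S , c , b≡ = k , (λ m → unpermute (v m)) , (λ m → SVec-unpermute (v m) (v∈S m)) , c , (λ y → b≡ (σ ⟨$⟩ˡ y))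

    independent′ : LinIndep p d (λ j → unpermute (b j))
    independent′ c zero-comb = independent c (λ i →
      subst (λ z → lincomb p d c b z ≡ 0 [mod p ]) (inverseˡ σ) (zero-comb (σ ⟨$⟩ʳ i)))

    spanning′ : ∀ u → SVec p ℓ a u → InSpanFam p d (λ j → unpermute (b j)) u
    spanning′ u (x , zero-sum , u≡x) with spanning (λ i → u (σ ⟨$⟩ʳ i))
                                            ((λ i → x (σ ⟨$⟩ʳ i)) , InS-permute x zero-sum , (λ i → u≡x (σ ⟨$⟩ʳ i)))
    ... | c , u≡comb = c , λ y → subst (λ z → u z ≡ lincomb p d c b (σ ⟨$⟩ˡ y) [mod p ]) (inverseʳ σ) (u≡comb (σ ⟨$⟩ˡ y))

TwoBlockShape : (p : ℕ) → (Fin p → Fin p) → ℕ → Fin p → Set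
TwoBlockShape p α t r = ∀ (i : Fin p) →
    (toℕ i < t → toℕ (α i) ≡ toℕ r)
  × (t ≤ toℕ i → toℕ i < p ∸ 2 → toℕ (α i) + toℕ r ≡ 0 [mod p ])
  × (p ∸ 2 ≤ toℕ i → toℕ (α i) + (t + 1) * toℕ r ≡ 0 [mod p ])

-- A sequence α of this shape, with t = t₁ + 1 ≥ 1 copies of r and s = s₁ + 1 ≥ 1 copies of
-- -r, whose two last positions I, J are never separated by a zero-sum subset, has
-- dimension p - 2.  We work with positions k ∈ ℕ: [0, t) carries r, [t, n) carries -r
-- (n = t + s) and n, n + 1 are the ends.  The basis is B_0 = all positions,
-- B_q = {q, t} for 0 < q < t and B_q = {0, q} for t ≤ q < n.  A combination Σ_q g_q B_q
-- has g_0 at the ends, g_0 + g_k at k ∉ {0, t}, and sums of g over a block at 0 and t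
-- (comb-end … comb-t); this makes the basis triangular (Independence), and expresses
-- a zero-sum subset with coordinates u by γ_0 = z, γ_k = u_k - z (Expansion), where the
-- coordinate t works out by the balance Σ_{[0,t)} u - Σ_{[t,n)} u ≡ 2 (t + 1) z.
module TwoBlockDimension (p : ℕ) ⦃ _ : NonZero p ⦄ (p-prime : Prime p) (α : Fin p → Fin p)
    (t₁ s₁ : ℕ) (size : suc (suc (suc t₁ + suc s₁)) ≡ p)
    (r : Fin p) (r≢0 : toℕ r ≢ 0) (shape : TwoBlockShape p α (suc t₁) r)
    (I J : Fin p) (I-pos : toℕ I ≡ suc t₁ + suc s₁) (J-pos : toℕ J ≡ suc (suc t₁ + suc s₁))
    (ends : ∀ x → InS p p α x → x I ≡ x J) where

  open Residues p
  open Field p-prime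
  open SumsModulo p
  open SubsetSums α using (weight)

  t s n ρ : ℕ
  t = suc t₁
  s = suc s₁
  n = t + s
  ρ = toℕ r

  p∸2≡n : p ∸ 2 ≡ n
  p∸2≡n = cong (_∸ 2) (sym size)

  n<p : n < p
  n<p = subst (n <_) size (m<n⇒m<1+n (n<1+n n))

  t<p : t < p
  t<p = <-trans (m<m+n t (s≤s z≤n)) n<p

  ρ≢0 : ¬ (ρ ≋ 0)
  ρ≢0 ρ≋0 = r≢0 (toℕ≋0 r ρ≋0)

  A : ℕ → ℕ
  A = extend (λ k → toℕ (α k))

  A-first : ∀ k → k < t → A k ≡ ρ
  A-first k k<t = trans (extend-fromℕ< _ k k<p) (proj₁ (shape (fromℕ< k<p)) (subst (_< t) (sym (toℕ-fromℕ< k<p)) k<t))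
    where k<p = <-trans k<t t<p

  A-middle : ∀ k → t ≤ k → k < n → A k + ρ ≋ 0
  A-middle k t≤k k<n = trans (≡⇒≋ (cong (_+ ρ) (extend-fromℕ< _ k k<p)))
    (mod⇒≋ (proj₁ (proj₂ (shape (fromℕ< k<p))) (subst (t ≤_) (sym pos) t≤k) (subst₂ _<_ (sym pos) (sym p∸2≡n) k<n)))
    where
    k<p = <-trans k<n n<p
    pos = toℕ-fromℕ< k<p

  A-end : ∀ k → n ≤ k → k < p → A k + (t + 1) * ρ ≋ 0
  A-end k n≤k k<p = trans (≡⇒≋ (cong (_+ (t + 1) * ρ) (extend-fromℕ< _ k k<p)))
    (mod⇒≋ (proj₂ (proj₂ (shape (fromℕ< k<p))) (subst₂ _≤_ (sym p∸2≡n) (sym (toℕ-fromℕ< k<p)) n≤k)))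

  weight-positional : ∀ (x : Fin p → Bool) → weight x ≡ sumTo p (λ k → A k * extend (λ i → bit (x i)) k)
  weight-positional x = trans (∑≡sumTo p _) (sumTo-cong p (λ k _ → extend-* (λ i → toℕ (α i)) (λ i → bit (x i)) k))

  sum-blocks : ∀ h → sumTo p h ≡ sumTo t h + (sumTo s (λ j → h (t + j)) + (h n + h (suc n)))
  sum-blocks h = begin
    sumTo p h                                     ≡⟨ cong (λ m → sumTo m h) (trans (regroup t₁ s₁) size) ⟨
    sumTo (t + (s + 2)) h                         ≡⟨ sumTo-split t (s + 2) h ⟩
    sumTo t h + sumTo (s + 2) (λ k → h (t + k))   ≡⟨ cong (sumTo t h +_) (sumTo-split s 2 (λ k → h (t + k))) ⟩
    sumTo t h + (sumTo s (λ j → h (t + j)) + (h (t + (s + 0)) + (h (t + (s + 1)) + 0)))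
                                                  ≡⟨ cong (λ e → sumTo t h + (sumTo s (λ j → h (t + j)) + e)) last-two ⟩
    sumTo t h + (sumTo s (λ j → h (t + j)) + (h n + h (suc n))) ∎
    where
    open ≡-Reasoning
    regroup : ∀ a b → suc a + (suc b + 2) ≡ suc (suc (suc a + suc b))
    regroup = solve-∀
    last-two : h (t + (s + 0)) + (h (t + (s + 1)) + 0) ≡ h n + h (suc n)
    last-two = cong₂ _+_ (cong (λ m → h (t + m)) (+-identityʳ s))
                         (trans (+-identityʳ _) (cong h (trans (cong (t +_) (+-comm s 1)) (+-suc t s))))

  first-block : ∀ (u : ℕ → ℕ) → sumTo t (λ k → A k * u k) ≡ ρ * sumTo t u
  first-block u = trans (sumTo-cong t (λ k k<t → cong (_* u k) (A-first k k<t))) (sumTo-*ˡ t ρ u)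

  middle-block : ∀ (u : ℕ → ℕ) → sumTo s (λ j → A (t + j) * u (t + j)) + ρ * sumTo s (λ j → u (t + j)) ≋ 0
  middle-block u = trans (≡⇒≋ (begin
    sumTo s au + ρ * sumTo s ut           ≡⟨ cong (sumTo s au +_) (sumTo-*ˡ s ρ ut) ⟨
    sumTo s au + sumTo s (λ j → ρ * ut j)  ≡⟨ sumTo-+ s au (λ j → ρ * ut j) ⟨
    sumTo s (λ j → au j + ρ * ut j)       ≡⟨ sumTo-cong s (λ j _ → *-distribʳ-+ (ut j) (A (t + j)) ρ) ⟨
    sumTo s (λ j → (A (t + j) + ρ) * ut j) ∎))
    (sumTo-≋0 s (λ j → (A (t + j) + ρ) * ut j) (λ j j<s → *-congʳ (ut j) (A-middle (t + j) (m≤m+n t j) (+-monoʳ-< t j<s))))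
    where
    open ≡-Reasoning
    au ut : ℕ → ℕ
    au j = A (t + j) * u (t + j)
    ut j = u (t + j)

  end-block : ∀ z → A n * z + A (suc n) * z + (z + z) * ((t + 1) * ρ) ≋ 0
  end-block z = begin
    A n * z + A (suc n) * z + (z + z) * ((t + 1) * ρ)        ≡⟨ regroup (A n) (A (suc n)) z ((t + 1) * ρ) ⟩
    (A n + (t + 1) * ρ) * z + (A (suc n) + (t + 1) * ρ) * z  ≈⟨ +-cong (*-congʳ z (A-end n ≤-refl n<p))
                                                                     (*-congʳ z (A-end (suc n) (n≤1+n n) (subst (suc n <_) size ≤-refl))) ⟩
    0 * z + 0 * z                                            ≡⟨⟩
    0                                                        ∎
    where
    open ≋-Reasoning
    regroup : ∀ a b z c → a * z + b * z + (z + z) * c ≡ (a + c) * z + (b + c) * z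
    regroup = solve-∀

  balance : ∀ (u : ℕ → ℕ) z → u n ≡ z → u (suc n) ≡ z →
            sumTo p (λ k → A k * u k) + ρ * sumTo s (λ j → u (t + j)) + (z + z) * ((t + 1) * ρ) ≋ ρ * sumTo t u
  balance u z un≡z un+1≡z = begin
    sumTo p h + ρ * SN + E
      ≡⟨ cong (λ w → w + ρ * SN + E) (sum-blocks h) ⟩
    sumTo t h + (M + (A n * u n + A (suc n) * u (suc n))) + ρ * SN + E
      ≡⟨ cong₃ (λ a b c → a + (M + (A n * b + A (suc n) * c)) + ρ * SN + E) (first-block u) un≡z un+1≡z ⟩
    ρ * SP + (M + (A n * z + A (suc n) * z)) + ρ * SN + E
      ≡⟨ regroup (ρ * SP) M (A n * z) (A (suc n) * z) (ρ * SN) E ⟩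
    ρ * SP + ((M + ρ * SN) + (A n * z + A (suc n) * z + E))
      ≈⟨ +-congˡ (ρ * SP) (+-cong middle (end-block z)) ⟩
    ρ * SP + 0
      ≡⟨ +-identityʳ (ρ * SP) ⟩
    ρ * SP ∎
    where
    open ≋-Reasoning
    h : ℕ → ℕ
    h k = A k * u k
    SP = sumTo t u
    SN = sumTo s (λ j → u (t + j))
    M = sumTo s (λ j → h (t + j))
    E = (z + z) * ((t + 1) * ρ)
    middle : M + ρ * SN ≋ 0
    middle = middle-block u
    cong₃ : ∀ (f : ℕ → ℕ → ℕ → ℕ) {a a′ b b′ c c′} → a ≡ a′ → b ≡ b′ → c ≡ c′ → f a b c ≡ f a′ b′ c′
    cong₃ f refl refl refl = refl
    regroup : ∀ P M x y N E → P + (M + (x + y)) + N + E ≡ P + ((M + N) + (x + y + E))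
    regroup = solve-∀

  inB : ℕ → ℕ → Bool
  inB zero    k = true
  inB (suc q) k = if does (suc q <? t) then does (k ≟ suc q) ∨ does (k ≟ t)
                                       else does (k ≟ 0) ∨ does (k ≟ suc q)

  inB-first : ∀ j k → suc j < t → inB (suc j) k ≡ does (k ≟ suc j) ∨ does (k ≟ t)
  inB-first j k j+1<t =
    cong (λ b → if b then does (k ≟ suc j) ∨ does (k ≟ t) else does (k ≟ 0) ∨ does (k ≟ suc j)) (dec-true (suc j <? t) j+1<t)

  inB-late : ∀ q k → ¬ (suc q < t) → inB (suc q) k ≡ does (k ≟ 0) ∨ does (k ≟ suc q)
  inB-late q k ¬first =
    cong (λ b → if b then does (k ≟ suc q) ∨ does (k ≟ t) else does (k ≟ 0) ∨ does (k ≟ suc q)) (dec-false (suc q <? t) ¬first)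

  inB-second : ∀ j k → inB (t + j) k ≡ does (k ≟ 0) ∨ does (k ≟ t + j)
  inB-second j k = inB-late (t₁ + j) k (m+n≮m t j)

  same : ∀ k → does (k ≟ k) ≡ true
  same k = dec-true (k ≟ k) refl

  above : ∀ {k m} → m < k → does (k ≟ m) ≡ false
  above m<k = dec-false (_ ≟ _) (>⇒≢ m<k)

  below : ∀ {k m} → k < m → does (k ≟ m) ≡ false
  below k<m = dec-false (_ ≟ _) (<⇒≢ k<m)

  neither : ∀ {a b} → a ≡ false → b ≡ false → a ∨ b ≡ false
  neither refl refl = refl

  firstTest secondTest : ℕ → ℕ → Bool
  firstTest  k j = does (k ≟ suc j) ∨ does (k ≟ t)
  secondTest k j = does (k ≟ 0) ∨ does (k ≟ t + j)

  comb : (ℕ → ℕ) → ℕ → ℕ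
  comb g k = sumTo n (λ q → g q * bit (inB q k))

  comb-blocks : ∀ (g : ℕ → ℕ) k → comb g k ≡ g 0 * 1 + (sumTo t₁ (λ j → g (suc j) * bit (firstTest k j))
                                             + sumTo s (λ j → g (t + j) * bit (secondTest k j)))
  comb-blocks g k = cong (g 0 * 1 +_) (trans (sumTo-split t₁ s (λ q → g (suc q) * bit (inB (suc q) k)))
    (cong₂ _+_ (sumTo-cong t₁ (λ j j<t₁ → cong (λ b → g (suc j) * bit b) (inB-first j k (s≤s j<t₁))))
               (sumTo-cong s (λ j _ → cong (λ b → g (t + j) * bit b) (inB-second j k)))))

  comb-from-blocks : ∀ (g : ℕ → ℕ) k {u v} →
    sumTo t₁ (λ j → g (suc j) * bit (firstTest k j)) ≡ u →
    sumTo s (λ j → g (t + j) * bit (secondTest k j)) ≡ v → comb g k ≡ g 0 + (u + v)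
  comb-from-blocks g k first second = trans (comb-blocks g k) (cong₂ _+_ (*-identityʳ (g 0)) (cong₂ _+_ first second))

  comb-end : ∀ (g : ℕ → ℕ) k → n ≤ k → comb g k ≡ g 0
  comb-end g k n≤k = trans (comb-from-blocks g k
    (sumTo-none t₁ (λ j → g (suc j)) (firstTest k)
       (λ j j<t₁ → neither (above (<-≤-trans (s≤s j<t₁) t≤k)) (above t<k)))
    (sumTo-none s (λ j → g (t + j)) (secondTest k)
       (λ j j<s → neither (above (<-≤-trans (s≤s z≤n) n≤k)) (above (<-≤-trans (+-monoʳ-< t j<s) n≤k)))))
    (+-identityʳ (g 0))
    where
    t≤k = ≤-trans (m≤m+n t s) n≤k
    t<k = <-≤-trans (m<m+n t (s≤s z≤n)) n≤k

  comb-first : ∀ (g : ℕ → ℕ) j → suc j < t → comb g (suc j) ≡ g 0 + g (suc j)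
  comb-first g j j+1<t = trans (comb-from-blocks g (suc j)
    (sumTo-one t₁ (λ j → g (suc j)) (firstTest (suc j)) j (≤-pred j+1<t) (cong (_∨ does (suc j ≟ t)) (same (suc j)))
       (λ i _ i≢j → neither (dec-false (_ ≟ _) (λ e → i≢j (sym (suc-injective e)))) (below j+1<t)))
    (sumTo-none s (λ j → g (t + j)) (secondTest (suc j))
       (λ i _ → neither refl (below (<-≤-trans j+1<t (m≤m+n t i))))))
    (cong (g 0 +_) (+-identityʳ (g (suc j))))

  comb-second : ∀ (g : ℕ → ℕ) j → 0 < j → j < s → comb g (t + j) ≡ g 0 + g (t + j)
  comb-second g j 0<j j<s = comb-from-blocks g (t + j)
    (sumTo-none t₁ (λ j → g (suc j)) (firstTest (t + j))
       (λ i i<t₁ → neither (above (<-≤-trans (s≤s i<t₁) (m≤m+n t j))) (above (m<m+n t 0<j))))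
    (sumTo-one s (λ j → g (t + j)) (secondTest (t + j)) j j<s
       (trans (cong (does (t + j ≟ 0) ∨_) (same (t + j))) (∨-zeroʳ (does (t + j ≟ 0))))
       (λ i _ i≢j → neither refl (dec-false (_ ≟ _) (λ e → i≢j (sym (+-cancelˡ-≡ t _ _ e))))))

  comb-zero : ∀ (g : ℕ → ℕ) → comb g 0 ≡ g 0 + sumTo s (λ j → g (t + j))
  comb-zero g = comb-from-blocks g 0
    (sumTo-none t₁ (λ j → g (suc j)) (firstTest 0) (λ _ _ → neither refl refl))
    (sumTo-all s (λ j → g (t + j)) (secondTest 0) (λ _ _ → refl))

  comb-t : ∀ (g : ℕ → ℕ) → comb g t ≡ g 0 + sumTo t₁ (λ j → g (suc j)) + g t
  comb-t g = trans (comb-from-blocks g t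
    (sumTo-all t₁ (λ j → g (suc j)) (firstTest t)
       (λ j _ → trans (cong (does (t ≟ suc j) ∨_) (same t)) (∨-zeroʳ (does (t ≟ suc j)))))
    (sumTo-one s (λ j → g (t + j)) (secondTest t) 0 (s≤s z≤n)
       (trans (cong (does (t ≟ 0) ∨_) (dec-true (t ≟ t + 0) (sym (+-identityʳ t)))) (∨-zeroʳ (does (t ≟ 0))))
       (λ i _ i≢0 → neither refl (below (m<m+n t (n≢0⇒n>0 i≢0))))))
    (trans (sym (+-assoc (g 0) _ _)) (cong (λ m → g 0 + sumTo t₁ (λ j → g (suc j)) + g m) (+-identityʳ t)))

  B : Fin (p ∸ 2) → Vector p
  B q k = bit (inB (toℕ q) (toℕ k))

  coeff : (Fin (p ∸ 2) → Fin p) → ℕ → ℕ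
  coeff c = extend (λ q → toℕ (c q))

  lincomb-comb : ∀ c k → lincomb p (p ∸ 2) c B k ≡ comb (coeff c) (toℕ k)
  lincomb-comb c k = trans (∑≡sumTo (p ∸ 2) _)
    (trans (sumTo-cong (p ∸ 2) (λ q _ → extend-*ʳ (λ q → toℕ (c q)) (λ q → bit (inB q (toℕ k))) q))
           (cong (λ m → sumTo m (λ q → coeff c q * bit (inB q (toℕ k)))) p∸2≡n))

  comb-cong≋ : ∀ {g g'} k → (∀ q → q < n → g q ≋ g' q) → comb g k ≋ comb g' k
  comb-cong≋ {g} {g'} k e = sumTo-cong≋ n (λ q q<n → *-congʳ (bit (inB q k)) (e q q<n))

  -- A vanishing combination has vanishing coefficients: read it at an end (g_0), at the
  -- positions k ∉ {0, t} (g_k), and at t (g_t).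
  module Independence (c : Fin (p ∸ 2) → Fin p) (vanishing : ∀ k → lincomb p (p ∸ 2) c B k ≡ 0 [mod p ]) where

    g : ℕ → ℕ
    g = coeff c

    vanish : ∀ k → k < p → comb g k ≋ 0
    vanish k k<p = subst (λ m → comb g m ≋ 0) (toℕ-fromℕ< k<p)
                     (trans (≡⇒≋ (sym (lincomb-comb c (fromℕ< k<p)))) (mod⇒≋ (vanishing (fromℕ< k<p))))

    g0 : g 0 ≋ 0
    g0 = trans (≡⇒≋ (sym (comb-end g n ≤-refl))) (vanish n n<p)

    without-g0 : ∀ {v} → g 0 + v ≋ 0 → v ≋ 0
    without-g0 {v} e = trans (sym (+-congʳ v g0)) e

    g-first : ∀ j → suc j < t → g (suc j) ≋ 0
    g-first j j+1<t = without-g0 (trans (≡⇒≋ (sym (comb-first g j j+1<t))) (vanish (suc j) (<-trans j+1<t t<p)))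

    g-second : ∀ j → 0 < j → j < s → g (t + j) ≋ 0
    g-second j 0<j j<s = without-g0 (trans (≡⇒≋ (sym (comb-second g j 0<j j<s))) (vanish (t + j) (<-trans (+-monoʳ-< t j<s) n<p)))

    g-t : g t ≋ 0
    g-t = begin
      g t                                       ≈⟨ +-congʳ (g t) (+-cong g0 (sumTo-≋0 t₁ (λ j → g (suc j)) (λ j j<t₁ → g-first j (s≤s j<t₁)))) ⟨
      g 0 + sumTo t₁ (λ j → g (suc j)) + g t    ≡⟨ comb-t g ⟨
      comb g t                                  ≈⟨ vanish t t<p ⟩
      0                                         ∎
      where open ≋-Reasoning

    g≋0 : ∀ q → q < n → g q ≋ 0
    g≋0 zero    _   = g0
    g≋0 (suc q) q<n with suc q <? t
    ... | yes first = g-first q first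
    ... | no  ¬first with suc q ≟ t
    ...   | yes q+1≡t = subst (λ m → g m ≋ 0) (sym q+1≡t) g-t
    ...   | no  q+1≢t = subst (λ m → g m ≋ 0) (m+[n∸m]≡n t≤q+1)
                          (g-second (suc q ∸ t) (m<n⇒0<n∸m t<q+1) (+-cancelˡ-< t _ _ (subst (_< n) (sym (m+[n∸m]≡n t≤q+1)) q<n)))
      where
      t≤q+1 = ≮⇒≥ ¬first
      t<q+1 = ≤∧≢⇒< t≤q+1 (λ e → q+1≢t (sym e))

  independent : LinIndep p (p ∸ 2) B
  independent c vanishing q =
    toℕ≋0 (c q) (subst (_≋ 0) (extend-toℕ _ q) (g≋0 (toℕ q) (subst (toℕ q <_) p∸2≡n (toℕ<n q))))
    where open Independence c vanishing

  -- the congruence left at position t once the balance relation is inserted: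
  -- z + t₁ (-z) - (z + N₁ + s₁ (-z)) + N₁ + 2 (t + 1) z ≡ (t₁ + s₁ + 4) z ≡ p z ≡ 0
  position-t-identity : ∀ u N₁ z → u + N₁ + (z + z) * (t + 1) + (z + t₁ * neg z + neg (z + (N₁ + s₁ * neg z))) ≋ u
  position-t-identity u N₁ z = begin
    u + N₁ + (z + z) * (t + 1) + (z + t₁ * ((p ∸ 1) * z) + (p ∸ 1) * (z + (N₁ + s₁ * ((p ∸ 1) * z))))
      ≡⟨ cong (λ q → u + N₁ + (z + z) * (t + 1) + (z + t₁ * (q * z) + q * (z + (N₁ + s₁ * (q * z))))) p∸1≡ ⟩
    u + N₁ + (z + z) * (t + 1) + (z + t₁ * (q′ * z) + q′ * (z + (N₁ + s₁ * (q′ * z))))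
      ≡⟨ expand u N₁ z t₁ s₁ ⟩
    u + (N₁ + ((2 + t₁ + s₁) + s₁ * (1 + t₁ + s₁)) * z) * (4 + t₁ + s₁)
      ≡⟨ cong (λ m → u + (N₁ + ((2 + t₁ + s₁) + s₁ * (1 + t₁ + s₁)) * z) * m) p≡ ⟩
    u + (N₁ + ((2 + t₁ + s₁) + s₁ * (1 + t₁ + s₁)) * z) * p
      ≈⟨ +-multiple u (N₁ + ((2 + t₁ + s₁) + s₁ * (1 + t₁ + s₁)) * z) ⟩
    u ∎
    where
    open ≋-Reasoning
    q′ = 3 + t₁ + s₁
    p≡ : 4 + t₁ + s₁ ≡ p
    p≡ = trans (four t₁ s₁) size
      where
      four : ∀ a b → 4 + a + b ≡ suc (suc (suc a + suc b))
      four = solve-∀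
    p∸1≡ : p ∸ 1 ≡ q′
    p∸1≡ = cong (_∸ 1) (sym p≡)
    expand : ∀ u N z a b → u + N + (z + z) * (suc a + 1) + (z + a * ((3 + a + b) * z) + (3 + a + b) * (z + (N + b * ((3 + a + b) * z))))
                           ≡ u + (N + ((2 + a + b) + b * (1 + a + b)) * z) * (4 + a + b)
    expand = solve-∀

  -- With u = x read on positions and z its common
  -- value at the ends, the coefficients are γ_0 = z, γ_k = u_k - z for k ∉ {0, t}, and γ_t
  -- chosen so that position 0 fits; position t then fits by the balance relation.
  module Expansion (x : Fin p → Bool) (zero-sum : InS p p α x) where

    U : ℕ → ℕ
    U = extend (λ k → bit (x k))

    z : ℕ
    z = bit (x I)

    U-end : ∀ k → n ≤ k → k < p → U k ≡ z
    U-end k n≤k k<p = trans (extend-fromℕ< _ k k<p) (at-end (m≤n⇒m<n∨m≡n n≤k))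
      where
      position : toℕ (fromℕ< k<p) ≡ k
      position = toℕ-fromℕ< k<p
      at-end : n < k ⊎ n ≡ k → bit (x (fromℕ< k<p)) ≡ z
      at-end (inj₂ n≡k) = cong (λ i → bit (x i)) (toℕ-injective (trans position (trans (sym n≡k) (sym I-pos))))
      at-end (inj₁ n<k) = trans (cong (λ i → bit (x i)) (toℕ-injective (trans position (trans k≡n+1 (sym J-pos)))))
                                (cong bit (sym (ends x zero-sum)))
        where
        k≡n+1 : k ≡ suc n
        k≡n+1 = ≤-antisym (≤-pred (subst (k <_) (sym size) k<p)) n<k

    P₁ N₁ : ℕ
    P₁ = sumTo t₁ (λ j → U (suc j))
    N₁ = sumTo s₁ (λ j → U (t + suc j))

    γt : ℕ
    γt = U 0 + neg (z + (N₁ + s₁ * neg z))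

    γ : ℕ → ℕ
    γ zero    = z
    γ (suc q) = if does (suc q ≟ t) then γt else U (suc q) + neg z

    γ-t : γ t ≡ γt
    γ-t = cong (λ b → if b then γt else U t + neg z) (same t)

    γ-other : ∀ q → 0 < q → q ≢ t → γ q ≡ U q + neg z
    γ-other (suc q) _ q+1≢t = cong (λ b → if b then γt else U (suc q) + neg z) (dec-false (suc q ≟ t) q+1≢t)

    C : Fin (p ∸ 2) → Fin p
    C q = residue (γ (toℕ q))

    C≋γ : ∀ q → q < n → coeff C q ≋ γ q
    C≋γ q q<n = trans (≡⇒≋ (extend-fromℕ< _ q q<n′)) (trans (residue≋ _) (≡⇒≋ (cong γ (toℕ-fromℕ< q<n′))))
      where q<n′ = subst (q <_) (sym p∸2≡n) q<n

    cancel-z : ∀ v → z + (v + neg z) ≋ v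
    cancel-z v = begin
      z + (v + neg z)   ≡⟨ shuffle z v (neg z) ⟩
      v + (neg z + z)   ≈⟨ +-congˡ v (neg-inverse z) ⟩
      v + 0             ≡⟨ +-identityʳ v ⟩
      v                 ∎
      where
      open ≋-Reasoning
      shuffle : ∀ a b c → a + (b + c) ≡ b + (c + a)
      shuffle = solve-∀

    balance-U : U 0 + P₁ ≋ U t + N₁ + (z + z) * (t + 1)
    balance-U = *-cancelˡ ρ ρ≢0 (begin
      ρ * (U 0 + P₁)                                         ≈⟨ balance U z (U-end n ≤-refl n<p) (U-end (suc n) (n≤1+n n) n+1<p) ⟨
      sumTo p (λ k → A k * U k) + ρ * SN + (z + z) * ((t + 1) * ρ)
                                                             ≈⟨ +-congʳ ((z + z) * ((t + 1) * ρ)) (+-congʳ (ρ * SN) weight≋0) ⟩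
      0 + ρ * SN + (z + z) * ((t + 1) * ρ)                   ≡⟨ factor ρ SN (z + z) (t + 1) ⟩
      ρ * (SN + (z + z) * (t + 1))                           ≡⟨ cong (λ m → ρ * (U m + N₁ + (z + z) * (t + 1))) (+-identityʳ t) ⟩
      ρ * (U t + N₁ + (z + z) * (t + 1))                     ∎)
      where
      open ≋-Reasoning
      SN = sumTo s (λ j → U (t + j))
      n+1<p : suc n < p
      n+1<p = subst (suc n <_) size ≤-refl
      weight≋0 : sumTo p (λ k → A k * U k) ≋ 0
      weight≋0 = trans (≡⇒≋ (sym (weight-positional x))) (mod⇒≋ zero-sum)
      factor : ∀ r a b c → 0 + r * a + b * (c * r) ≡ r * (a + b * c)
      factor = solve-∀

    fits-end : ∀ k → n ≤ k → k < p → comb γ k ≋ U k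
    fits-end k n≤k k<p = ≡⇒≋ (trans (comb-end γ k n≤k) (sym (U-end k n≤k k<p)))

    fits-first : ∀ j → suc j < t → comb γ (suc j) ≋ U (suc j)
    fits-first j j+1<t = begin
      comb γ (suc j)           ≡⟨ comb-first γ j j+1<t ⟩
      z + γ (suc j)            ≡⟨ cong (z +_) (γ-other (suc j) (s≤s z≤n) (<⇒≢ j+1<t)) ⟩
      z + (U (suc j) + neg z)  ≈⟨ cancel-z (U (suc j)) ⟩
      U (suc j)                ∎
      where open ≋-Reasoning

    fits-second : ∀ j → 0 < j → j < s → comb γ (t + j) ≋ U (t + j)
    fits-second j 0<j j<s = begin
      comb γ (t + j)           ≡⟨ comb-second γ j 0<j j<s ⟩
      z + γ (t + j)            ≡⟨ cong (z +_) (γ-other (t + j) (<-≤-trans (s≤s z≤n) (m≤m+n t j)) (>⇒≢ (m<m+n t 0<j))) ⟩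
      z + (U (t + j) + neg z)  ≈⟨ cancel-z (U (t + j)) ⟩
      U (t + j)                ∎
      where open ≋-Reasoning

    fits-zero : comb γ 0 ≋ U 0
    fits-zero = begin
      comb γ 0                                          ≡⟨ comb-zero γ ⟩
      z + (γ (t + 0) + sumTo s₁ (λ j → γ (t + suc j)))  ≡⟨ cong₂ (λ a b → z + (a + b)) (trans (cong γ (+-identityʳ t)) γ-t) second-block ⟩
      z + (γt + (N₁ + s₁ * neg z))                      ≡⟨ shuffle z (U 0) (neg (z + (N₁ + s₁ * neg z))) (N₁ + s₁ * neg z) ⟩
      U 0 + (neg (z + (N₁ + s₁ * neg z)) + (z + (N₁ + s₁ * neg z)))
                                                        ≈⟨ +-congˡ (U 0) (neg-inverse _) ⟩
      U 0 + 0                                           ≡⟨ +-identityʳ (U 0) ⟩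
      U 0                                               ∎
      where
      open ≋-Reasoning
      t+1+j≢t : ∀ j → t + suc j ≢ t
      t+1+j≢t j e = m≢1+m+n t (sym (trans (sym (+-suc t j)) e))
      second-block : sumTo s₁ (λ j → γ (t + suc j)) ≡ N₁ + s₁ * neg z
      second-block = trans (sumTo-cong s₁ (λ j _ → γ-other (t + suc j) (s≤s z≤n) (t+1+j≢t j)))
                           (trans (sumTo-+ s₁ (λ j → U (t + suc j)) (λ _ → neg z)) (cong (N₁ +_) (sumTo-const s₁ (neg z))))
      shuffle : ∀ z u m w → z + ((u + m) + w) ≡ u + (m + (z + w))
      shuffle = solve-∀

    fits-t : comb γ t ≋ U t
    fits-t = begin
      comb γ t                                    ≡⟨ comb-t γ ⟩
      z + sumTo t₁ (λ j → γ (suc j)) + γ t        ≡⟨ cong₂ (λ a b → z + a + b) first-block′ γ-t ⟩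
      z + (P₁ + t₁ * neg z) + γt                  ≡⟨ shuffle z P₁ (t₁ * neg z) (U 0) (neg (z + (N₁ + s₁ * neg z))) ⟩
      U 0 + P₁ + (z + t₁ * neg z + neg (z + (N₁ + s₁ * neg z)))
                                                  ≈⟨ +-congʳ (z + t₁ * neg z + neg (z + (N₁ + s₁ * neg z))) balance-U ⟩
      U t + N₁ + (z + z) * (t + 1) + (z + t₁ * neg z + neg (z + (N₁ + s₁ * neg z)))
                                                  ≈⟨ position-t-identity (U t) N₁ z ⟩
      U t                                         ∎
      where
      open ≋-Reasoning
      first-block′ : sumTo t₁ (λ j → γ (suc j)) ≡ P₁ + t₁ * neg z
      first-block′ = trans (sumTo-cong t₁ (λ j j<t₁ → γ-other (suc j) (s≤s z≤n) (<⇒≢ (s≤s j<t₁))))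
                           (trans (sumTo-+ t₁ (λ j → U (suc j)) (λ _ → neg z)) (cong (P₁ +_) (sumTo-const t₁ (neg z))))
      shuffle : ∀ z P m u w → z + (P + m) + (u + w) ≡ u + P + (z + m + w)
      shuffle = solve-∀

    fits : ∀ k → k < p → comb γ k ≋ U k
    fits zero _ = fits-zero
    fits (suc k) k+1<p with suc k <? t
    ... | yes first = fits-first k first
    ... | no  ¬first with suc k ≟ t
    ...   | yes k+1≡t = subst (λ m → comb γ m ≋ U m) (sym k+1≡t) fits-t
    ...   | no  k+1≢t with n ≤? suc k
    ...     | yes end  = fits-end (suc k) end k+1<p
    ...     | no  ¬end = subst (λ m → comb γ m ≋ U m) (m+[n∸m]≡n t≤k+1)
                           (fits-second (suc k ∸ t) (m<n⇒0<n∸m t<k+1)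
                             (+-cancelˡ-< t _ _ (subst (_< n) (sym (m+[n∸m]≡n t≤k+1)) (≰⇒> ¬end))))
      where
      t≤k+1 = ≮⇒≥ ¬first
      t<k+1 = ≤∧≢⇒< t≤k+1 (λ e → k+1≢t (sym e))

  spanning : ∀ u → SVec p p α u → InSpanFam p (p ∸ 2) B u
  spanning u (x , zero-sum , u≡x) = C , λ k → ≋⇒mod (begin
      u k                     ≡⟨ u≡x k ⟩
      bit (x k)               ≡⟨ extend-toℕ _ k ⟨
      U (toℕ k)               ≈⟨ fits (toℕ k) (toℕ<n k) ⟨
      comb γ (toℕ k)          ≈⟨ comb-cong≋ (toℕ k) C≋γ ⟨
      comb (coeff C) (toℕ k)  ≡⟨ lincomb-comb C k ⟨
      lincomb p (p ∸ 2) C B k ∎)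
    where
    open Expansion x zero-sum
    open ≋-Reasoning

  members : ℕ → Fin p → Bool
  members q k = inB q (toℕ k)

  weight-members : ∀ q → weight (members q) ≡ sumTo p (λ k → A k * bit (inB q k))
  weight-members q = trans (∑≡sumTo p _) (sumTo-cong p (λ k _ → extend-*ʳ (λ i → toℕ (α i)) (λ k → bit (inB q k)) k))

  -- each B_q is a zero-sum subset: all of α sums to r (t - s - 2 (t + 1)) ≡ -p r, and the
  -- pairs {q, t}, {0, q} consist of an r and a -r
  members-zero-sum : ∀ q → q < n → sumTo p (λ k → A k * bit (inB q k)) ≋ 0
  members-zero-sum zero _ = +-cancelʳ (ρ * t) (begin
    sumTo p (λ k → A k * 1) + ρ * t                             ≈⟨ +-multiple _ ρ ⟨
    sumTo p (λ k → A k * 1) + ρ * t + ρ * p                     ≡⟨ cong (λ m → sumTo p (λ k → A k * 1) + ρ * t + ρ * m) (sym size) ⟩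
    sumTo p (λ k → A k * 1) + ρ * t + ρ * (2 + (t + s))         ≡⟨ regroup (sumTo p (λ k → A k * 1)) ρ t₁ s₁ ⟩
    sumTo p (λ k → A k * 1) + ρ * (s * 1) + (1 + 1) * ((t + 1) * ρ)
                                                                ≡⟨ cong (λ a → sumTo p (λ k → A k * 1) + ρ * a + (1 + 1) * ((t + 1) * ρ))
                                                                     (sym (sumTo-const s 1)) ⟩
    sumTo p (λ k → A k * 1) + ρ * sumTo s (λ _ → 1) + (1 + 1) * ((t + 1) * ρ)
                                                                ≈⟨ balance (λ _ → 1) 1 refl refl ⟩
    ρ * sumTo t (λ _ → 1)                                       ≡⟨ cong (ρ *_) (trans (sumTo-const t 1) (*-identityʳ t)) ⟩
    ρ * t                                                       ≡⟨⟩
    0 + ρ * t                                                   ∎)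
    where
    open ≋-Reasoning
    regroup : ∀ X r a b → X + r * suc a + r * (2 + (suc a + suc b)) ≡ X + r * (suc b * 1) + (1 + 1) * ((suc a + 1) * r)
    regroup = solve-∀
  members-zero-sum (suc q) q<n with suc q <? t
  ... | yes first = begin
    sumTo p (λ k → A k * bit (inB (suc q) k))  ≡⟨ sumTo-cong p (λ k _ → cong (λ b → A k * bit b) (inB-first q k first)) ⟩
    sumTo p (λ k → A k * bit (firstTest k q))  ≡⟨ sumTo-two p A (λ k → firstTest k q) (suc q) t first t<p
                                                   (cong (_∨ does (suc q ≟ t)) (same (suc q)))
                                                   (trans (cong (does (t ≟ suc q) ∨_) (same t)) (∨-zeroʳ (does (t ≟ suc q))))
                                                   (λ k _ k≢q+1 k≢t → neither (dec-false (k ≟ suc q) k≢q+1) (dec-false (k ≟ t) k≢t)) ⟩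
    A (suc q) + A t                            ≡⟨ cong (_+ A t) (A-first (suc q) first) ⟩
    ρ + A t                                    ≡⟨ +-comm ρ (A t) ⟩
    A t + ρ                                    ≈⟨ A-middle t ≤-refl (m<m+n t (s≤s z≤n)) ⟩
    0                                          ∎
    where open ≋-Reasoning
  ... | no ¬first = begin
    sumTo p (λ k → A k * bit (inB (suc q) k))  ≡⟨ sumTo-cong p (λ k _ → cong (λ b → A k * bit b) (inB-late q k ¬first)) ⟩
    sumTo p (λ k → A k * bit (does (k ≟ 0) ∨ does (k ≟ suc q)))
                                               ≡⟨ sumTo-two p A (λ k → does (k ≟ 0) ∨ does (k ≟ suc q)) 0 (suc q) (s≤s z≤n) (<-trans q<n n<p)
                                                   refl (trans (cong (does (suc q ≟ 0) ∨_) (same (suc q))) (∨-zeroʳ (does (suc q ≟ 0))))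
                                                   (λ k _ k≢0 k≢q+1 → neither (dec-false (k ≟ 0) k≢0) (dec-false (k ≟ suc q) k≢q+1)) ⟩
    A 0 + A (suc q)                            ≡⟨ cong (_+ A (suc q)) (A-first 0 (s≤s z≤n)) ⟩
    ρ + A (suc q)                              ≡⟨ +-comm ρ (A (suc q)) ⟩
    A (suc q) + ρ                              ≈⟨ A-middle (suc q) (≮⇒≥ ¬first) q<n ⟩
    0                                          ∎
    where open ≋-Reasoning

  B-in-S : ∀ q → SVec p p α (B q)
  B-in-S q = members (toℕ q) , ≋⇒mod (trans (≡⇒≋ (weight-members (toℕ q))) (members-zero-sum (toℕ q) q<n)) , (λ _ → refl)
    where q<n = subst (toℕ q <_) p∸2≡n (toℕ<n q)

  dimension : DimEq p p α (p ∸ 2)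
  dimension = B , (λ q → member-in-span p (SVec p p α) (B q) (B-in-S q)) , independent , spanning

module ExceptionalPair (p : ℕ) ⦃ _ : NonZero p ⦄ (p-prime : Prime p) (a : Fin p → Fin p)
    (nonzero : ∀ i → toℕ (a i) ≢ 0) (i₀ j₀ : Fin p) (i₀≢j₀ : i₀ ≢ j₀)
    (unseparated : ∀ x → InS p p a x → x i₀ ≡ x j₀) where

  open Residues p
  open Field p-prime
  open SubsetSums a
  open SubsetSumGrowth p p-prime a

  nonzero≋ : ∀ i → ¬ (toℕ (a i) ≋ 0)
  nonzero≋ i e = nonzero i (toℕ≋0 (a i) e)

  one-end-completion : ∀ x e → x i₀ ≡ false → x j₀ ≡ false → e ≡ i₀ ⊎ e ≡ j₀ →
                       ¬ (weight x + toℕ (a e) ≋ 0)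
  one-end-completion x _ xi₀ xj₀ (inj₁ refl) zero-sum
    with unseparated (insert x i₀) (≋⇒mod (trans (≡⇒≋ (weight-insert x i₀ xi₀)) zero-sum))
  ... | same with trans (sym (insert-here x i₀)) (trans same (trans (insert-there x i₀ j₀ (≢-sym i₀≢j₀)) xj₀))
  ...   | ()
  one-end-completion x _ xi₀ xj₀ (inj₂ refl) zero-sum
    with unseparated (insert x j₀) (≋⇒mod (trans (≡⇒≋ (weight-insert x j₀ xj₀)) zero-sum))
  ... | same with trans (sym (insert-here x j₀)) (trans (sym same) (trans (insert-there x j₀ i₀ i₀≢j₀) xi₀))
  ...   | ()

  R : List (Fin p)
  R = remove j₀ (remove i₀ (allFin p))

  R-unique : Unique R
  R-unique = filter⁺ _ (filter⁺ _ (allFin⁺ p))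

  ∈R⁺ : ∀ {k} → k ≢ i₀ → k ≢ j₀ → k ∈ R
  ∈R⁺ {k} k≢i₀ k≢j₀ = ∈-remove⁺ (∈-remove⁺ (∈-allFin k) k≢i₀) k≢j₀

  ∈R⁻ : ∀ {k} → k ∈ R → k ≢ i₀ × k ≢ j₀
  ∈R⁻ k∈R = let k∈R' , k≢j₀ = ∈-remove⁻ (remove i₀ (allFin p)) k∈R in proj₂ (∈-remove⁻ (allFin p) k∈R') , k≢j₀

  length-R : suc (suc (length R)) ≡ p
  length-R = begin
    suc (suc (length R))                 ≡⟨ cong suc (length-remove j₀ _ (filter⁺ _ (allFin⁺ p)) (∈-remove⁺ (∈-allFin j₀) (≢-sym i₀≢j₀))) ⟩
    suc (length (remove i₀ (allFin p)))  ≡⟨ length-remove i₀ _ (allFin⁺ p) (∈-allFin i₀) ⟩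
    length (allFin p)                    ≡⟨ length-tabulate (λ k → k) ⟩
    p                                    ∎
    where open ≡-Reasoning

  avoids-ends : ∀ {D} x → SupportedIn D x → (∀ {k} → k ∈ D → k ∈ R) → x i₀ ≡ false × x j₀ ≡ false
  avoids-ends x x⊆D D⊆R = x⊆D i₀ (λ i₀∈D → proj₁ (∈R⁻ (D⊆R i₀∈D)) refl)
                        , x⊆D j₀ (λ j₀∈D → proj₂ (∈R⁻ (D⊆R j₀∈D)) refl)

  target : ℕ → Fin p
  target u = residue (neg u)

  target-injective : ∀ {u v} → target u ≡ target v → u ≋ v
  target-injective e = neg-injective (residue-injective e)

  hit-target : ∀ x u → residue (weight x) ≡ target u → weight x + u ≋ 0
  hit-target x u hit = trans (+-congʳ u (residue-injective hit)) (neg-inverse u)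

  -- Otherwise -a_{i₀} ≠ -a_{j₀}, and subset-sum growth
  -- over the p - 2 indices of R hits one of them; adding that end gives a zero-sum
  -- subset containing exactly one end.
  ends-equal : a i₀ ≡ a j₀
  ends-equal with a i₀ ≟ᶠ a j₀
  ... | yes same = same
  ... | no  different with subset-sum-hits R R-unique (λ k _ → nonzero≋ k) G G-unique _ (here refl) enough
    where
    G : List (Fin p)
    G = target (toℕ (a i₀)) ∷ target (toℕ (a j₀)) ∷ []
    G-unique : Unique G
    G-unique = ((λ e → different (toℕ-injective (≋⇒≡ (toℕ<n _) (toℕ<n _) (target-injective e)))) ∷ []) ∷ [] ∷ []
    enough : p ≤ length R + length G
    enough = ≤-reflexive (trans (sym length-R) (+-comm 2 (length R)))
  ... | x , x⊆R , hit with avoids-ends x x⊆R (λ k∈R → k∈R)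
  ...   | xi₀ , xj₀ with hit
  ...     | here hit-i₀         = ⊥-elim (one-end-completion x i₀ xi₀ xj₀ (inj₁ refl) (hit-target x _ hit-i₀))
  ...     | there (here hit-j₀) = ⊥-elim (one-end-completion x j₀ xi₀ xj₀ (inj₂ refl) (hit-target x _ hit-j₀))

  -- Two indices k₁ ≠ k₂ of R whose values are neither equal nor opposite are impossible:
  -- with c = a_{i₀}, the four residues -(c + Σ E) for E ⊆ {k₁, k₂} are distinct, subset-sum
  -- growth over the p - 4 other indices of R hits one of them, and adding E and i₀ then
  -- gives a zero-sum subset containing i₀ but not j₀.
  module NeitherEqualNorOpposite (k₁ k₂ : Fin p) (k₁≢k₂ : k₁ ≢ k₂) (k₁∈R : k₁ ∈ R) (k₂∈R : k₂ ∈ R)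
      (unequal : ¬ (toℕ (a k₁) ≋ toℕ (a k₂))) (not-opposite : ¬ (toℕ (a k₁) + toℕ (a k₂) ≋ 0)) where

    c a₁ a₂ : ℕ
    c  = toℕ (a i₀)
    a₁ = toℕ (a k₁)
    a₂ = toℕ (a k₂)

    D : List (Fin p)
    D = remove k₂ (remove k₁ R)

    D-unique : Unique D
    D-unique = filter⁺ _ (filter⁺ _ R-unique)

    ∈D⁻ : ∀ {k} → k ∈ D → k ∈ R × k ≢ k₁ × k ≢ k₂
    ∈D⁻ k∈D = let k∈D' , k≢k₂ = ∈-remove⁻ (remove k₁ R) k∈D
                  k∈R  , k≢k₁ = ∈-remove⁻ R k∈D'
              in k∈R , k≢k₁ , k≢k₂

    enough : p ≤ length D + 4
    enough = ≤-reflexive (begin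
      p                                    ≡⟨ length-R ⟨
      suc (suc (length R))                 ≡⟨ cong (λ n → suc (suc n)) (length-remove k₁ R R-unique k₁∈R) ⟨
      suc (suc (suc (length (remove k₁ R)))) ≡⟨ cong (λ n → suc (suc (suc n)))
                                                (length-remove k₂ _ (filter⁺ _ R-unique) (∈-remove⁺ k₂∈R (≢-sym k₁≢k₂))) ⟨
      4 + length D                         ≡⟨ +-comm 4 (length D) ⟩
      length D + 4                         ∎)
      where open ≡-Reasoning

    Es : List (List (Fin p))
    Es = [] ∷ (k₁ ∷ []) ∷ (k₂ ∷ []) ∷ (k₁ ∷ k₂ ∷ []) ∷ []

    G : List (Fin p)
    G = map (λ E → target (c + listSum E)) Es

    apart : ∀ {u v} → ¬ (u ≋ v) → target (c + u) ≢ target (c + v)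
    apart u≢v e = u≢v (+-cancelˡ c (target-injective e))

    plus0 : ∀ u → u + 0 ≋ u
    plus0 u = ≡⇒≋ (+-identityʳ u)

    -- the four targets are distinct: a coincidence would force a₁ ≡ 0, a₂ ≡ 0,
    -- a₁ + a₂ ≡ 0 or a₁ ≡ a₂
    G-unique : Unique G
    G-unique = (apart (λ e → nonzero≋ k₁ (sym (trans e (plus0 a₁))))
             ∷ apart (λ e → nonzero≋ k₂ (sym (trans e (plus0 a₂))))
             ∷ apart (λ e → not-opposite (sym (trans e (≡⇒≋ (cong (a₁ +_) (+-identityʳ a₂))))))
             ∷ [])
             ∷ (apart (λ e → unequal (trans (sym (plus0 a₁)) (trans e (plus0 a₂))))
             ∷ apart (λ e → nonzero≋ k₂ (sym (trans (+-cancelˡ a₁ e) (plus0 a₂))))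
             ∷ [])
             ∷ (apart (λ e → nonzero≋ k₁ (sym (trans (+-cancelˡ a₂ (trans e (≡⇒≋ (swap a₁ a₂)))) (plus0 a₁))))
             ∷ [])
             ∷ [] ∷ []
      where
      swap : ∀ u v → u + (v + 0) ≡ v + (u + 0)
      swap = solve-∀

    parts : ∀ {E} → E ∈ Es → Unique E × (∀ {e} → e ∈ E → e ≡ k₁ ⊎ e ≡ k₂)
    parts (here refl)                         = [] , λ ()
    parts (there (here refl))                 = [] ∷ [] , λ { (here refl) → inj₁ refl }
    parts (there (there (here refl)))         = [] ∷ [] , λ { (here refl) → inj₂ refl }
    parts (there (there (there (here refl)))) = (k₁≢k₂ ∷ []) ∷ [] ∷ []
                                              , λ { (here refl) → inj₁ refl ; (there (here refl)) → inj₂ refl }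

    completion : ∀ x → SupportedIn D x → ∀ {E} → E ∈ Es → residue (weight x) ≡ target (c + listSum E) → ⊥
    completion x x⊆D {E} E∈Es hit-E = one-end-completion y i₀ yi₀ yj₀ (inj₁ refl) zero-sum
      where
      E-unique = proj₁ (parts E∈Es)
      E⊆k₁k₂ = proj₂ (parts E∈Es)
      E⊆R : ∀ {e} → e ∈ E → e ∈ R
      E⊆R e∈E with E⊆k₁k₂ e∈E
      ... | inj₁ refl = k₁∈R
      ... | inj₂ refl = k₂∈R
      x-off-E : ∀ e → e ∈ E → x e ≡ false
      x-off-E e e∈E = x⊆D e (λ e∈D → off (E⊆k₁k₂ e∈E) (∈D⁻ e∈D))
        where
        off : e ≡ k₁ ⊎ e ≡ k₂ → ¬ (e ∈ R × e ≢ k₁ × e ≢ k₂)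
        off (inj₁ refl) (_ , k₁≢k₁ , _) = k₁≢k₁ refl
        off (inj₂ refl) (_ , _ , k₂≢k₂) = k₂≢k₂ refl
      y = insertAll x E
      ends-off = avoids-ends x x⊆D (λ k∈D → proj₁ (∈D⁻ k∈D))
      yi₀ : y i₀ ≡ false
      yi₀ = trans (insertAll-∉ x E i₀ (λ i₀∈E → proj₁ (∈R⁻ (E⊆R i₀∈E)) refl)) (proj₁ ends-off)
      yj₀ : y j₀ ≡ false
      yj₀ = trans (insertAll-∉ x E j₀ (λ j₀∈E → proj₂ (∈R⁻ (E⊆R j₀∈E)) refl)) (proj₂ ends-off)
      zero-sum : weight y + c ≋ 0
      zero-sum = begin
        weight y + c                  ≡⟨ cong (_+ c) (weight-insertAll x E E-unique x-off-E) ⟩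
        weight x + listSum E + c      ≡⟨ shuffle (weight x) (listSum E) c ⟩
        weight x + (c + listSum E)    ≈⟨ hit-target x (c + listSum E) hit-E ⟩
        0                             ∎
        where
        open ≋-Reasoning
        shuffle : ∀ u v w → u + v + w ≡ u + (w + v)
        shuffle = solve-∀

    impossible : ⊥
    impossible with subset-sum-hits D D-unique (λ k _ → nonzero≋ k) G G-unique _ (here refl) enough
    ... | x , x⊆D , hit with ∈-map⁻ (λ E → target (c + listSum E)) hit
    ...   | E , E∈Es , hit-E = completion x x⊆D E∈Es hit-E

  equal-or-opposite : ∀ k₁ k₂ → k₁ ≢ k₂ → k₁ ∈ R → k₂ ∈ R →
                      toℕ (a k₁) ≋ toℕ (a k₂) ⊎ toℕ (a k₁) + toℕ (a k₂) ≋ 0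
  equal-or-opposite k₁ k₂ k₁≢k₂ k₁∈R k₂∈R
    with toℕ (a k₁) ≋? toℕ (a k₂) | toℕ (a k₁) + toℕ (a k₂) ≋? 0
  ... | yes equal   | _               = inj₁ equal
  ... | no  _       | yes opposite    = inj₂ opposite
  ... | no  unequal | no not-opposite =
    ⊥-elim (NeitherEqualNorOpposite.impossible k₁ k₂ k₁≢k₂ k₁∈R k₂∈R unequal not-opposite)

  R-sum-avoids : ∀ L → Unique L → All (_∈ R) L → ¬ (listSum L + toℕ (a i₀) ≋ 0)
  R-sum-avoids L uL L⊆R zero-sum =
    one-end-completion (indicator L) i₀ (off i₀ proj₁) (off j₀ proj₂) (inj₁ refl)
      (trans (≡⇒≋ (cong (_+ toℕ (a i₀)) (weight-indicator L uL))) zero-sum)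
    where
    off : ∀ e → (∀ {k} → k ≢ i₀ × k ≢ j₀ → k ≢ e) → indicator L e ≡ false
    off e which = indicator-∉ (λ e∈L → which (∈R⁻ (All.lookup L⊆R e∈L)) refl)

  CaseOne CaseTwo : Set
  CaseOne = DimEq p p a 1 × Σ[ r ∈ Fin p ] (toℕ r ≢ 0 × (∀ i → a i ≡ r))
  CaseTwo = DimEq p p a (p ∸ 2) × Σ[ t ∈ ℕ ] (1 ≤ t × t ≤ p ∸ 3 × Σ[ σ ∈ Permutation′ p ] Σ[ r ∈ Fin p ]
              (toℕ r ≢ 0 × TwoBlockShape p (λ i → a (σ ⟨$⟩ʳ i)) t r))

  constant-case : ∀ k → (∀ i → a i ≡ a k) → CaseOne
  constant-case k constant = constant-dim1 p p-prime a (a k) (nonzero k) constant , a k , nonzero k , constant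

  module Split (k₀ : Fin p) (k₀∈R : k₀ ∈ R) where

    r c : ℕ
    r = toℕ (a k₀)
    c = toℕ (a i₀)

    same? : ∀ k → Dec (a k ≡ a k₀)
    same? k = a k ≟ᶠ a k₀

    P N : List (Fin p)
    P = filter same? R
    N = filter (λ k → ¬? (same? k)) R

    t s : ℕ
    t = length P
    s = length N

    t+s+2≡p : suc (suc (t + s)) ≡ p
    t+s+2≡p = trans (cong (λ n → suc (suc n)) (length-partition same? R)) length-R

    P-unique : Unique P
    P-unique = filter⁺ same? R-unique

    N-unique : Unique N
    N-unique = filter⁺ _ R-unique

    P-values : All (λ k → k ∈ R × a k ≡ a k₀) P
    P-values = All.tabulate (∈-filter⁻ same? {xs = R})

    N-values : All (λ k → k ∈ R × toℕ (a k) + r ≋ 0) N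
    N-values = All.tabulate λ k∈N → let k∈R , a-k≢r = ∈-filter⁻ (λ k → ¬? (same? k)) {xs = R} k∈N
                                     in k∈R , opposite k∈R a-k≢r
      where
      opposite : ∀ {k} → k ∈ R → a k ≢ a k₀ → toℕ (a k) + r ≋ 0
      opposite {k} k∈R a-k≢r with equal-or-opposite k k₀ (λ { refl → a-k≢r refl }) k∈R k₀∈R
      ... | inj₁ equal = ⊥-elim (a-k≢r (toℕ-injective (≋⇒≡ (toℕ<n _) (toℕ<n _) equal)))
      ... | inj₂ opp   = opp

    k₀∈P : k₀ ∈ P
    k₀∈P = ∈-filter⁺ same? k₀∈R refl

    t≥1 : 1 ≤ t
    t≥1 = ∈⇒length≥1 k₀∈P

    listSum-P : ∀ {L} → All (λ k → k ∈ R × a k ≡ a k₀) L → listSum L ≡ length L * r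
    listSum-P []                  = refl
    listSum-P ((_ , a-k≡r) ∷ rest) = cong₂ _+_ (cong toℕ a-k≡r) (listSum-P rest)

    listSum-N : ∀ {L} → All (λ k → k ∈ R × toℕ (a k) + r ≋ 0) L → listSum L + length L * r ≋ 0
    listSum-N []                     = refl
    listSum-N {k ∷ L} ((_ , opp) ∷ rest) = begin
      toℕ (a k) + listSum L + (r + length L * r)      ≡⟨ shuffle (toℕ (a k)) (listSum L) r (length L * r) ⟩
      (toℕ (a k) + r) + (listSum L + length L * r)    ≈⟨ +-cong opp (listSum-N rest) ⟩
      0                                               ∎
      where
      open ≋-Reasoning
      shuffle : ∀ u v w z → u + v + (w + z) ≡ (u + w) + (v + z)
      shuffle = solve-∀

    -- -c is not a multiple m r with m ≤ t: the first m indices of P sum to m r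
    not-P-multiple : ∀ m → m ≤ t → ¬ (m * r + c ≋ 0)
    not-P-multiple m m≤t mr+c≋0 = R-sum-avoids L (take⁺ᵘ m P-unique) (All.map proj₁ (take⁺ m P-values)) (begin
      listSum L + c        ≡⟨ cong (_+ c) (listSum-P (take⁺ m P-values)) ⟩
      length L * r + c     ≡⟨ cong (λ n → n * r + c) (length-take≤ m P m≤t) ⟩
      m * r + c            ≈⟨ mr+c≋0 ⟩
      0                    ∎)
      where
      open ≋-Reasoning
      L = take m P

    -- nor with t + 1 < m < p: the first p - m indices of N sum to -(p - m) r ≡ m r
    not-N-multiple : ∀ m → suc t < m → m < p → ¬ (m * r + c ≋ 0)
    not-N-multiple m t+1<m m<p mr+c≋0 = R-sum-avoids L (take⁺ᵘ q N-unique) (All.map proj₁ (take⁺ q N-values))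
      (+-cancelʳ (q * r + m * r) (begin
        listSum L + c + (q * r + m * r)    ≡⟨ shuffle (listSum L) c (q * r) (m * r) ⟩
        (listSum L + q * r) + (m * r + c)  ≈⟨ +-cong L+qr≋0 mr+c≋0 ⟩
        0                                  ≈⟨ multiple≋0 r ⟨
        r * p                              ≡⟨ *-comm r p ⟩
        p * r                              ≡⟨ cong (_* r) (m∸n+n≡m (<⇒≤ m<p)) ⟨
        (q + m) * r                        ≡⟨ *-distribʳ-+ r q m ⟩
        0 + (q * r + m * r)                ∎))
      where
      open ≋-Reasoning
      q = p ∸ m
      q≤s : q ≤ s
      q≤s = ≤-trans (∸-monoʳ-≤ p t+1<m) (≤-reflexive (trans (cong (_∸ suc (suc t)) (sym t+s+2≡p)) (m+n∸m≡n t s)))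
      L = take q N
      L+qr≋0 : listSum L + q * r ≋ 0
      L+qr≋0 = subst (λ n → listSum L + n * r ≋ 0) (length-take≤ q N q≤s) (listSum-N (take⁺ q N-values))
      shuffle : ∀ u v w z → u + v + (w + z) ≡ (u + w) + (z + v)
      shuffle = solve-∀

    -- The ends have value c ≡ -(t + 1) r: write -c ≡ m r with m < p; the two lemmas
    -- above leave only m = t + 1.
    end-value : c + suc t * r ≋ 0
    end-value with solve-linear r c (nonzero≋ k₀)
    ... | m , m<p , mr+c≋0 with <-cmp m (suc t)
    ...   | tri< m<t+1 _ _ = ⊥-elim (not-P-multiple m (≤-pred m<t+1) mr+c≋0)
    ...   | tri≈ _ m≡t+1 _ = trans (≡⇒≋ (trans (+-comm c _) (cong (λ n → n * r + c) (sym m≡t+1)))) mr+c≋0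
    ...   | tri> _ _ t+1<m = ⊥-elim (not-N-multiple m t+1<m m<p mr+c≋0)

    -- If N is empty, then t = p - 2 and the ends have value c ≡ -(p - 1) r ≡ r.
    ends-value : s ≡ 0 → a i₀ ≡ a k₀
    ends-value s≡0 = toℕ-injective (≋⇒≡ (toℕ<n _) (toℕ<n _) (+-cancelʳ (neg r) (begin
      c + neg r        ≡⟨ cong (λ m → c + m * r) t+1≡p-1 ⟨
      c + suc t * r    ≈⟨ end-value ⟩
      0                ≈⟨ neg-inverse r ⟨
      neg r + r        ≡⟨ +-comm (neg r) r ⟩
      r + neg r        ∎)))
      where
      open ≋-Reasoning
      t+1≡p-1 : suc t ≡ p ∸ 1
      t+1≡p-1 = trans (cong suc (sym (+-identityʳ t))) (cong (_∸ 1) (trans (cong (λ m → suc (suc (t + m))) (sym s≡0)) t+s+2≡p))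

    all-equal : s ≡ 0 → ∀ i → a i ≡ a k₀
    all-equal s≡0 i with i ≟ᶠ i₀ | i ≟ᶠ j₀
    ... | yes refl | _        = ends-value s≡0
    ... | no  _    | yes refl = trans (sym ends-equal) (ends-value s≡0)
    ... | no i≢i₀  | no i≢j₀ with same? i
    ...   | yes a-i≡r = a-i≡r
    ...   | no  a-i≢r = ⊥-elim (<⇒≢ (∈⇒length≥1 i∈N) (sym s≡0))
      where i∈N = ∈-filter⁺ (λ k → ¬? (same? k)) (∈R⁺ i≢i₀ i≢j₀) a-i≢r

    arrangement : List (Fin p)
    arrangement = P ++ N ++ i₀ ∷ j₀ ∷ []

    arrangement-unique : Unique arrangement
    arrangement-unique = ++⁺ P-unique (++⁺ N-unique ((i₀≢j₀ ∷ []) ∷ [] ∷ []) N∩ends) P∩rest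
      where
      not-end : ∀ {v} → v ∈ R → v ∉ i₀ ∷ j₀ ∷ []
      not-end v∈R (here refl)         = proj₁ (∈R⁻ v∈R) refl
      not-end v∈R (there (here refl)) = proj₂ (∈R⁻ v∈R) refl
      N∩ends : ∀ {v} → ¬ (v ∈ N × v ∈ i₀ ∷ j₀ ∷ [])
      N∩ends (v∈N , v∈ends) = not-end (proj₁ (All.lookup N-values v∈N)) v∈ends
      P∩rest : ∀ {v} → ¬ (v ∈ P × v ∈ N ++ i₀ ∷ j₀ ∷ [])
      P∩rest (v∈P , v∈rest) with ∈-filter⁻ same? {xs = R} v∈P | ∈-++⁻ N v∈rest
      ... | _   , a-v≡r | inj₁ v∈N    = proj₂ (∈-filter⁻ (λ k → ¬? (same? k)) {xs = R} v∈N) a-v≡r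
      ... | v∈R , _     | inj₂ v∈ends = not-end v∈R v∈ends

    arrangement-complete : ∀ y → y ∈ arrangement
    arrangement-complete y with y ≟ᶠ i₀ | y ≟ᶠ j₀
    ... | yes refl | _        = ∈-++⁺ʳ P (∈-++⁺ʳ N (here refl))
    ... | no  _    | yes refl = ∈-++⁺ʳ P (∈-++⁺ʳ N (there (here refl)))
    ... | no y≢i₀  | no y≢j₀ with same? y
    ...   | yes a-y≡r = ∈-++⁺ˡ (∈-filter⁺ same? (∈R⁺ y≢i₀ y≢j₀) a-y≡r)
    ...   | no  a-y≢r = ∈-++⁺ʳ P (∈-++⁺ˡ (∈-filter⁺ (λ k → ¬? (same? k)) (∈R⁺ y≢i₀ y≢j₀) a-y≢r))

    arrangement-length : length arrangement ≡ p
    arrangement-length = trans (length-++ P) (trans (cong (t +_) (length-++ N)) (trans (regroup t s) t+s+2≡p))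
      where
      regroup : ∀ t s → t + (s + 2) ≡ suc (suc (t + s))
      regroup = solve-∀

    open Enumeration i₀ arrangement arrangement-unique arrangement-complete arrangement-length using (σ)

    at-first : ∀ k → k < t → nth i₀ arrangement k ∈ P
    at-first k k<t = subst (_∈ P) (sym (nth-++ˡ i₀ P _ k k<t)) (nth-∈ i₀ P k k<t)

    at-middle : ∀ j → j < s → nth i₀ arrangement (t + j) ∈ N
    at-middle j j<s = subst (_∈ N) (sym (trans (nth-++ʳ i₀ P _ j) (nth-++ˡ i₀ N _ j j<s))) (nth-∈ i₀ N j j<s)

    at-end : ∀ j → j < 2 → nth i₀ arrangement (t + (s + j)) ≡ nth i₀ (i₀ ∷ j₀ ∷ []) j
    at-end j _ = trans (nth-++ʳ i₀ P _ (s + j)) (nth-++ʳ i₀ N _ j)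

    p∸2≡t+s : p ∸ 2 ≡ t + s
    p∸2≡t+s = cong (_∸ 2) (sym t+s+2≡p)

    arranged-shape : TwoBlockShape p (λ i → a (σ ⟨$⟩ʳ i)) t (a k₀)
    arranged-shape i = first , middle , last
      where
      k = toℕ i
      first : k < t → toℕ (a (σ ⟨$⟩ʳ i)) ≡ r
      first k<t = cong toℕ (proj₂ (All.lookup P-values (at-first k k<t)))
      middle : t ≤ k → k < p ∸ 2 → toℕ (a (σ ⟨$⟩ʳ i)) + r ≡ 0 [mod p ]
      middle t≤k k<p∸2 = ≋⇒mod (subst (λ m → toℕ (a (nth i₀ arrangement m)) + r ≋ 0) (m+[n∸m]≡n t≤k)
                                      (proj₂ (All.lookup N-values (at-middle (k ∸ t) j<s))))
        where
        j<s : k ∸ t < s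
        j<s = +-cancelˡ-< t _ _ (subst₂ _<_ (sym (m+[n∸m]≡n t≤k)) p∸2≡t+s k<p∸2)
      last : p ∸ 2 ≤ k → toℕ (a (σ ⟨$⟩ʳ i)) + (t + 1) * r ≡ 0 [mod p ]
      last p∸2≤k = ≋⇒mod (trans (≡⇒≋ (cong₂ (λ u m → toℕ (a u) + m * r) position (+-comm t 1)))
                                (trans (≡⇒≋ (cong (λ u → toℕ u + suc t * r) (end-value-of j<2))) end-value))
        where
        t+s≤k = subst (_≤ k) p∸2≡t+s p∸2≤k
        j = k ∸ (t + s)
        j<2 : j < 2
        j<2 = +-cancelˡ-< (t + s) _ _ (subst₂ _<_ (sym (m+[n∸m]≡n t+s≤k)) (trans (sym t+s+2≡p) (+-comm 2 (t + s))) (toℕ<n i))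
        position : σ ⟨$⟩ʳ i ≡ nth i₀ (i₀ ∷ j₀ ∷ []) j
        position = trans (cong (nth i₀ arrangement) (trans (sym (m+[n∸m]≡n t+s≤k)) (+-assoc t s j))) (at-end j j<2)
        end-value-of : ∀ {j} → j < 2 → a (nth i₀ (i₀ ∷ j₀ ∷ []) j) ≡ a i₀
        end-value-of {0}           _ = refl
        end-value-of {1}           _ = sym ends-equal
        end-value-of {suc (suc _)} (s≤s (s≤s ()))

    t+s<p : t + s < p
    t+s<p = subst (t + s <_) t+s+2≡p (m<n⇒m<1+n (n<1+n (t + s)))

    I J : Fin p
    I = fromℕ< t+s<p
    J = fromℕ< (subst (suc (t + s) <_) t+s+2≡p (n<1+n (suc (t + s))))

    σI≡i₀ : σ ⟨$⟩ʳ I ≡ i₀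
    σI≡i₀ = trans (cong (nth i₀ arrangement) (trans (toℕ-fromℕ< _) (cong (t +_) (sym (+-identityʳ s))))) (at-end 0 (s≤s z≤n))

    σJ≡j₀ : σ ⟨$⟩ʳ J ≡ j₀
    σJ≡j₀ = trans (cong (nth i₀ arrangement) (trans (toℕ-fromℕ< _) (trans (sym (+-suc t s)) (cong (t +_) (+-comm 1 s)))))
                  (at-end 1 (s≤s (s≤s z≤n)))

    arranged-ends : ∀ x → InS p p (λ i → a (σ ⟨$⟩ʳ i)) x → x I ≡ x J
    arranged-ends x zero-sum = subst₂ (λ u v → x u ≡ x v) (back σI≡i₀) (back σJ≡j₀) (unseparated _ (InS-unpermute x zero-sum))
      where
      open Permuted a σ
      back : ∀ {K e} → σ ⟨$⟩ʳ K ≡ e → σ ⟨$⟩ˡ e ≡ K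
      back refl = inverseˡ σ

    two-blocks : 1 ≤ s → CaseTwo
    two-blocks s≥1 = dim-unpermute (p ∸ 2) (TwoBlockDimension.dimension p p-prime aσ t₁ s₁ size (a k₀) (nonzero k₀)
                                              (subst (λ u → TwoBlockShape p aσ u (a k₀)) (sym t≡) arranged-shape)
                                              I J I-pos J-pos arranged-ends)
                   , t , t≥1 , t≤p-3 , σ , a k₀ , nonzero k₀ , arranged-shape
      where
      open Permuted a σ
      t₁ = t ∸ 1
      s₁ = s ∸ 1
      t≡ : suc t₁ ≡ t
      t≡ = m+[n∸m]≡n t≥1
      s≡ : suc s₁ ≡ s
      s≡ = m+[n∸m]≡n s≥1
      size : suc (suc (suc t₁ + suc s₁)) ≡ p
      size = trans (cong₂ (λ u v → suc (suc (u + v))) t≡ s≡) t+s+2≡p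
      I-pos : toℕ I ≡ suc t₁ + suc s₁
      I-pos = trans (toℕ-fromℕ< _) (sym (cong₂ _+_ t≡ s≡))
      J-pos : toℕ J ≡ suc (suc t₁ + suc s₁)
      J-pos = trans (toℕ-fromℕ< _) (sym (cong suc (cong₂ _+_ t≡ s≡)))
      t≤p-3 : t ≤ p ∸ 3
      t≤p-3 = subst (t ≤_) (trans (sym (+-∸-assoc t s≥1)) (cong (_∸ 3) t+s+2≡p)) (m≤m+n t (s ∸ 1))

    classify : CaseOne ⊎ CaseTwo
    classify with s ≟ 0
    ... | yes s≡0 = inj₁ (constant-case k₀ (all-equal s≡0))
    ... | no  s≢0 = inj₂ (two-blocks (n≢0⇒n>0 s≢0))

  classify : CaseOne ⊎ CaseTwo
  classify with R in R≡
  ... | []     = inj₁ (constant-case i₀ only-ends)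
    where
    only-ends : ∀ i → a i ≡ a i₀
    only-ends i with i ≟ᶠ i₀ | i ≟ᶠ j₀
    ... | yes refl | _        = refl
    ... | no  _    | yes refl = sym ends-equal
    ... | no i≢i₀  | no i≢j₀ with subst (i ∈_) R≡ (∈R⁺ i≢i₀ i≢j₀)
    ...   | ()
  ... | k₀ ∷ _ = Split.classify k₀ (subst (k₀ ∈_) (sym R≡) (here refl))

proposition4p2 : (p : ℕ) → Prime p → (a : Fin p → Fin p) → (∀ i → toℕ (a i) ≢ 0) →
    Exceptional p p a →
    (DimEq p p a 1 × Σ[ r ∈ Fin p ] (toℕ r ≢ 0 × (∀ i → a i ≡ r)))
    ⊎ (DimEq p p a (p ∸ 2) ×
       Σ[ t ∈ ℕ ] (1 ≤ t × t ≤ p ∸ 3 × Σ[ σ ∈ Permutation′ p ] Σ[ r ∈ Fin p ] (toℕ r ≢ 0 × (∀ (i : Fin p) →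
         (toℕ i < t → toℕ (a (σ ⟨$⟩ʳ i)) ≡ toℕ r)
         × (t ≤ toℕ i → toℕ i < p ∸ 2 → toℕ (a (σ ⟨$⟩ʳ i)) + toℕ r ≡ 0 [mod p ])
         × (p ∸ 2 ≤ toℕ i → toℕ (a (σ ⟨$⟩ʳ i)) + (t + 1) * toℕ r ≡ 0 [mod p ])))))
proposition4p2 p p-prime a nonzero (i₀ , j₀ , i₀≢j₀ , unseparated) =
  ExceptionalPair.classify p ⦃ prime⇒nonZero p-prime ⦄ p-prime a nonzero i₀ j₀ i₀≢j₀ unseparated
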